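{- Let $P$ be an $R$-labeled poset with fixed $R$-labeling $\lambda$, and let $\mathcal{C}$ be a chain in $P$. Then \[ \mathrm{Poin}_{\mathcal{C}}(P;y)=\sum_{\ell\ge 0}\left(y^\ell\cdot\sum_{\substack{\mathcal{D}\in\mathsf{IL}(\mathcal{C})\\ \mathsf{irank}(\mathcal{C},\mathcal{D})=\ell}}\#\,\mathsf{IncDec}(\mathcal{C},\mathcal{D})\right). \]
   Context: A graded poset $P$ of rank $n$ is a finite poset with unique minimum $\hat 0$ (rank $0$) and unique maximum $\hat 1$ (rank $n$) such that ${\sf rank}(X)$ equals the length of every maximal chain from $\hat 0$ to $X$. A chain is a (possibly empty) totally ordered subset. For a graded poset $Q$ with minimum $\hat 0_Q$ and Möbius function $\mu$, $\mathrm{Poin}(Q;y)=\sum_{X\in Q}|\mu(\hat 0_Q,X)|\,y^{{\sf rank}_Q(X)}$. For a chain $\mathcal{C}=\{\mathcal{C}_1<\dots<\mathcal{C}_k\}$, $\mathrm{Poin}_{\mathcal{C}}(P;y)=\prod_{i=1}^k\mathrm{Poin}([\mathcal{C}_i,\mathcal{C}_{i+1}];y)$ with $\mathcal{C}_{k+1}=\hat 1$ (empty product $=1$). An $R$-labeling of $P$ is a map $\lambda$ from cover relations to positive integers such that every interval $[X,Y]$ has a unique maximal chain with weakly increasing labels; $P$ is $R$-labeled if it is finite, graded and admits one. A multichain $\mathcal{D}=\{\{\mathcal{D}_1\le\dots\le\mathcal{D}_k\}\}$ (totally ordered multiset) interlaces $\mathcal{C}$ if $\mathcal{C}_1\le\mathcal{D}_1\le\mathcal{C}_2\le\mathcal{D}_2\le\dots\le\mathcal{C}_k\le\mathcal{D}_k$;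 then $(\mathcal{C},\mathcal{D})$ is an interlacing pair, $\mathsf{IL}(\mathcal{C})$ is the set of multichains interlacing $\mathcal{C}$, and $\mathsf{irank}(\mathcal{C},\mathcal{D})=\sum_i{\sf rank}(\mathcal{D}_i)-\sum_i{\sf rank}(\mathcal{C}_i)$. A maximal chain $\mathcal{M}=\{\mathcal{M}_0\lessdot\dots\lessdot\mathcal{M}_n\}$ decreases along $[\mathcal{M}_i,\mathcal{M}_j]$ if $\lambda(\mathcal{M}_i,\mathcal{M}_{i+1})>\dots>\lambda(\mathcal{M}_{j-1},\mathcal{M}_j)$ and weakly increases along it if these labels are $\le$ in order. $\mathsf{IncDec}(\mathcal{C},\mathcal{D})$ is the set of maximal chains $\mathcal{M}$ of $P$ containing all $\mathcal{C}_i,\mathcal{D}_i$ which decrease along every interval $[\mathcal{C}_i,\mathcal{D}_i]$ and weakly increase along $[\hat 0,\mathcal{C}_1]$, every $[\mathcal{D}_i,\mathcal{C}_{i+1}]$ ($i<k$), and $[\mathcal{D}_k,\hat 1]$ (for $k=0$: weakly increase along $[\hat 0,\hat 1]$). -}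

module Defs where

open import Data.Bool using (Bool; true; false; T; _∧_; not; if_then_else_)
open import Data.Nat using (ℕ; zero; suc; _+_; _*_; _∸_; _≤_; _≡ᵇ_; _≤ᵇ_; _<ᵇ_)
open import Data.Integer using (ℤ; -_; ∣_∣) renaming (_+_ to _+ℤ_; 0ℤ to 0ℤ; 1ℤ to 1ℤ)
open import Data.Fin using (Fin; _≟_)
open import Data.List using (List; []; _∷_; length; map; foldr; allFin; upTo; concatMap; zip) renaming (filterᵇ to filter)
open import Data.Bool.ListAction using (any; all)
open import Data.Nat.ListAction using (sum)
open import Data.Product using (Σ; _×_; _,_)
open import Relation.Nullary.Decidable using (⌊_⌋)
open import Relation.Binary.PropositionalEquality using (_≡_)

record FinPoset : Set₁ where
  field
    N        : ℕ
    leq      : Fin N → Fin N → Bool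
    reflexive : ∀ x → T (leq x x)
    antisym  : ∀ x y → T (leq x y) → T (leq y x) → x ≡ y
    transitive : ∀ x y z → T (leq x y) → T (leq y z) → T (leq x z)

module PosetDefs (P : FinPoset) where
  open FinPoset P public

  El : Set
  El = Fin N

  elems : List El
  elems = allFin N

  eqb : El → El → Bool
  eqb x y = ⌊ x ≟ y ⌋

  lt : El → El → Bool
  lt x y = leq x y ∧ not (eqb x y)

  cov : El → El → Bool
  cov x y = lt x y ∧ not (any (λ z → lt x z ∧ lt z y) elems)

  consec : List El → List (El × El)
  consec []           = []
  consec (x ∷ [])     = []
  consec (x ∷ y ∷ xs) = (x , y) ∷ consec (y ∷ xs)

  headIs : El → List El → Bool
  headIs a []      = false
  headIs a (x ∷ _) = eqb a x

  lastIs : El → List El → Bool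
  lastIs a []           = false
  lastIs a (x ∷ [])     = eqb a x
  lastIs a (x ∷ y ∷ xs) = lastIs a (y ∷ xs)

  -- c = (a = x₀ ⋖ x₁ ⋖ … ⋖ x_m = b) : a maximal chain of the interval [a,b]
  satFromTo : List El → El → El → Bool
  satFromTo c a b = headIs a c ∧ lastIs b c ∧ all (λ p → cov (Data.Product.proj₁ p) (Data.Product.proj₂ p)) (consec c)

  isChain : List El → Bool
  isChain c = all (λ p → lt (Data.Product.proj₁ p) (Data.Product.proj₂ p)) (consec c)

  lists : ℕ → List (List El)
  lists zero    = [] ∷ []
  lists (suc m) = concatMap (λ x → map (x ∷_) (lists m)) elems

  -- The fuel argument bounds the recursion depth; fuel N suffices since
  -- every strict chain in P has fewer than N steps.
  sumℤ : List ℤ → ℤ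
  sumℤ = foldr _+ℤ_ 0ℤ

  muF : ℕ → El → El → ℤ
  muF zero    x y = 0ℤ
  muF (suc f) x y =
    if eqb x y then 1ℤ
    else if lt x y then - sumℤ (map (muF f x) (filter (λ z → leq x z ∧ lt z y) elems))
    else 0ℤ

  μ : El → El → ℤ
  μ = muF N

record IsGraded (P : FinPoset) : Set where
  open PosetDefs P
  field
    bot    : El
    top    : El
    bot-min : ∀ x → T (leq bot x)
    top-max : ∀ x → T (leq x top)
    rank   : El → ℕ
    graded : ∀ (X : El) (c : List El) → T (satFromTo c bot X) → length c ≡ suc (rank X)

-- Polynomials in y with ℕ coefficients, as coefficient sequences.
Poly : Set
Poly = ℕ → ℕ

onePoly : Poly
onePoly zero    = 1
onePoly (suc _) = 0

_⊛_ : Poly → Poly → Poly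
(f ⊛ g) ℓ = sum (map (λ i → f i * g (ℓ ∸ i)) (upTo (suc ℓ)))

module GradedDefs (P : FinPoset) (G : IsGraded P) where
  open PosetDefs P public
  open IsGraded G public

  poinInt : El → El → Poly
  poinInt A B ℓ =
    sum (map (λ X → ∣ μ A X ∣)
             (filter (λ X → leq A X ∧ leq X B ∧ ((rank X ∸ rank A) ≡ᵇ ℓ)) elems))

  poinC : List El → Poly
  poinC []           = onePoly
  poinC (c ∷ [])     = poinInt c top
  poinC (c ∷ d ∷ cs) = poinInt c d ⊛ poinC (d ∷ cs)

  interlaces : List El → List El → Bool
  interlaces []       []       = true
  interlaces (c ∷ []) (d ∷ []) = leq c d
  interlaces (c ∷ c' ∷ cs) (d ∷ ds) = leq c d ∧ leq d c' ∧ interlaces (c' ∷ cs) ds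
  interlaces _ _ = false

  IL : List El → List (List El)
  IL C = filter (interlaces C) (lists (length C))

  irank : List El → List El → ℕ
  irank C D = sum (map rank D) ∸ sum (map rank C)

  -- maximal chains of P (all have n + 1 elements, n = rank 1̂)
  maxChains : List (List El)
  maxChains = filter (λ M → satFromTo M bot top) (lists (suc (rank top)))

  module Labels (lab : El → El → ℕ) where
    labs : List El → List ℕ
    labs c = map (λ p → lab (Data.Product.proj₁ p) (Data.Product.proj₂ p)) (consec c)

    weakInc : List ℕ → Bool
    weakInc []           = true
    weakInc (x ∷ [])     = true
    weakInc (x ∷ y ∷ xs) = (x ≤ᵇ y) ∧ weakInc (y ∷ xs)

    strictDec : List ℕ → Bool
    strictDec []           = true
    strictDec (x ∷ [])     = true
    strictDec (x ∷ y ∷ xs) = (y <ᵇ x) ∧ strictDec (y ∷ xs)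

    dropTo : El → List El → List El
    dropTo a []       = []
    dropTo a (x ∷ xs) = if eqb a x then x ∷ xs else dropTo a xs

    takeTo : El → List El → List El
    takeTo b []       = []
    takeTo b (x ∷ xs) = if eqb b x then x ∷ [] else x ∷ takeTo b xs

    seg : El → El → List El → List El
    seg a b M = takeTo b (dropTo a M)

    memb : El → List El → Bool
    memb a M = any (eqb a) M

    -- intervals along which M must weakly increase:
    -- [0̂,C₁], [D_i,C_{i+1}] (i<k), [D_k,1̂]; for k = 0 just [0̂,1̂]
    incPairs : El → List El → List El → List (El × El)
    incPairs s []       _        = (s , top) ∷ []
    incPairs s (c ∷ cs) []       = []
    incPairs s (c ∷ cs) (d ∷ ds) = (s , c) ∷ incPairs d cs ds

    isIncDec : List El → List El → List El → Bool
    isIncDec C D M =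
      all (λ a → memb a M) C ∧ all (λ a → memb a M) D ∧
      all (λ p → strictDec (labs (seg (Data.Product.proj₁ p) (Data.Product.proj₂ p) M))) (zip C D) ∧
      all (λ p → weakInc (labs (seg (Data.Product.proj₁ p) (Data.Product.proj₂ p) M))) (incPairs bot C D)

    #IncDec : List El → List El → ℕ
    #IncDec C D = length (filter (isIncDec C D) maxChains)

    rhsCoeff : List El → Poly
    rhsCoeff C ℓ = sum (map (λ D → if irank C D ≡ᵇ ℓ then #IncDec C D else 0) (IL C))

  record IsRLabeling (lab : El → El → ℕ) : Set where
    open Labels lab
    field
      positive : ∀ x y → T (cov x y) → 1 ≤ lab x y
      unique-inc : ∀ X Y → T (leq X Y) →
        Σ (List El) λ c → T (satFromTo c X Y ∧ weakInc (labs c)) ×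
          (∀ c' → T (satFromTo c' X Y ∧ weakInc (labs c')) → c' ≡ c)

module Submission where

-- Cutting a maximal chain of [s, t] at one of its elements c identifies the maximal
-- chains through c with pairs of maximal chains of [s, c] and [c, t].  Since every
-- interval has exactly one weakly increasing maximal chain, this factors #IncDec(C, D)
-- as the product over i of the number of strictly decreasing maximal chains of
-- [C_i, D_i].  That number is |μ(C_i, D_i)|: the function z ↦ (-1)^(rk z - rk a) times
-- the number of decreasing chains of [a, z] satisfies the recursion defining μ(a, -),
-- because its sum over [a, x] regroups, maximal chain by maximal chain of [a, x], into
-- the alternating sum Σ_j (-1)^j [l_1 > ... > l_j] [l_(j+1) ≤ ... ≤ l_m] over the label
-- word l_1 ... l_m of the chain, which vanishes for m ≥ 1.  Finally, multiplying out
-- Poin_C(P; y) with this description of |μ| gives a sum over the multichains D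
-- interlacing C, each contributing that product to the coefficient of y^irank(C, D).

open import Algebra.Bundles using (CommutativeSemiring)
open import Data.Bool using (T)
open import Data.List using (List)
open import Data.Nat using (ℕ)
open import Data.Product using (Σ)
open import Defs
open import Level using (0ℓ)
open import Relation.Binary.PropositionalEquality using (_≡_)

module ListSum (R : CommutativeSemiring 0ℓ 0ℓ) where

  open import Data.Bool using (Bool; true; false; T; _∧_; if_then_else_)
  open import Data.Empty using (⊥-elim)
  open import Data.Fin using (Fin)
  import Data.Fin.Properties as Fin
  open import Data.List using (List; []; _∷_; _++_; map; concatMap; filterᵇ; allFin; tabulate)
  open import Data.List.Properties using (map-tabulate)
  open import Data.List.Relation.Unary.All using (All; []; _∷_)
  open import Data.Nat using (zero; suc)
  open import Function using (id; _∘_)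
  import Relation.Binary.PropositionalEquality as ≡
  open import Relation.Nullary using (¬_)

  open CommutativeSemiring R
  open import Algebra.Properties.CommutativeSemigroup +-commutativeSemigroup using (interchange)
  open import Relation.Binary.Reasoning.Setoid setoid
  open ≡ using (_≢_)

  private variable
    A B : Set

  ∑ : List A → (A → Carrier) → Carrier
  ∑ []       f = 0#
  ∑ (x ∷ xs) f = f x + ∑ xs f

  syntax ∑ xs (λ x → e) = ∑[ x ∈ xs ] e

  ⟦_⟧ : Bool → Carrier
  ⟦ true  ⟧ = 1#
  ⟦ false ⟧ = 0#

  ∑-cong-All : ∀ {xs : List A} {f g : A → Carrier} → All (λ x → f x ≈ g x) xs → ∑ xs f ≈ ∑ xs g
  ∑-cong-All []       = refl
  ∑-cong-All (e ∷ es) = +-cong e (∑-cong-All es)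

  ∑-cong : ∀ (xs : List A) {f g : A → Carrier} → (∀ x → f x ≈ g x) → ∑ xs f ≈ ∑ xs g
  ∑-cong []       e = refl
  ∑-cong (x ∷ xs) e = +-cong (e x) (∑-cong xs e)

  ∑-zero : ∀ (xs : List A) {f : A → Carrier} → (∀ x → f x ≈ 0#) → ∑ xs f ≈ 0#
  ∑-zero []       e = refl
  ∑-zero (x ∷ xs) e = trans (+-cong (e x) (∑-zero xs e)) (+-identityˡ 0#)

  ∑-++ : ∀ (xs ys : List A) f → ∑ (xs ++ ys) f ≈ ∑ xs f + ∑ ys f
  ∑-++ []       ys f = sym (+-identityˡ _)
  ∑-++ (x ∷ xs) ys f = trans (+-congˡ (∑-++ xs ys f)) (sym (+-assoc _ _ _))

  ∑-map : ∀ (h : A → B) xs f → ∑ (map h xs) f ≈ ∑ xs (λ x → f (h x))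
  ∑-map h []       f = refl
  ∑-map h (x ∷ xs) f = +-congˡ (∑-map h xs f)

  ∑-concatMap : ∀ (h : A → List B) xs f → ∑ (concatMap h xs) f ≈ ∑[ x ∈ xs ] ∑ (h x) f
  ∑-concatMap h []       f = refl
  ∑-concatMap h (x ∷ xs) f = trans (∑-++ (h x) (concatMap h xs) f) (+-congˡ (∑-concatMap h xs f))

  ∑-filter : ∀ (p : A → Bool) xs f → ∑ (filterᵇ p xs) f ≈ ∑[ x ∈ xs ] (⟦ p x ⟧ * f x)
  ∑-filter p []       f = refl
  ∑-filter p (x ∷ xs) f with p x
  ... | true  = +-cong (sym (*-identityˡ _)) (∑-filter p xs f)
  ... | false = trans (∑-filter p xs f) (sym (trans (+-congʳ (zeroˡ (f x))) (+-identityˡ _)))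

  ∑-distrib-+ : ∀ (xs : List A) f g → ∑[ x ∈ xs ] (f x + g x) ≈ ∑ xs f + ∑ xs g
  ∑-distrib-+ []       f g = sym (+-identityˡ 0#)
  ∑-distrib-+ (x ∷ xs) f g = trans (+-congˡ (∑-distrib-+ xs f g)) (interchange (f x) (g x) _ _)

  *-distribˡ-∑ : ∀ c (xs : List A) f → c * ∑ xs f ≈ ∑[ x ∈ xs ] (c * f x)
  *-distribˡ-∑ c []       f = zeroʳ c
  *-distribˡ-∑ c (x ∷ xs) f = trans (distribˡ c (f x) _) (+-congˡ (*-distribˡ-∑ c xs f))

  *-distribʳ-∑ : ∀ c (xs : List A) f → ∑ xs f * c ≈ ∑[ x ∈ xs ] (f x * c)
  *-distribʳ-∑ c xs f = trans (*-comm _ c) (trans (*-distribˡ-∑ c xs f) (∑-cong xs (λ x → *-comm c (f x))))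

  ∑-comm : ∀ (xs : List A) (ys : List B) (f : A → B → Carrier) →
    ∑[ x ∈ xs ] ∑[ y ∈ ys ] f x y ≈ ∑[ y ∈ ys ] ∑[ x ∈ xs ] f x y
  ∑-comm []       ys f = sym (∑-zero ys (λ _ → refl))
  ∑-comm (x ∷ xs) ys f = trans (+-congˡ (∑-comm xs ys f)) (sym (∑-distrib-+ ys (f x) _))

  ∑-separable : ∀ (xs : List A) (ys : List B) (u : A → Carrier) (v : B → Carrier) →
    ∑[ x ∈ xs ] ∑[ y ∈ ys ] (u x * v y) ≈ ∑ xs u * ∑ ys v
  ∑-separable xs ys u v = begin
    ∑[ x ∈ xs ] ∑[ y ∈ ys ] (u x * v y) ≈⟨ ∑-cong xs (λ x → sym (*-distribˡ-∑ (u x) ys v)) ⟩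
    ∑[ x ∈ xs ] (u x * ∑ ys v)          ≈⟨ *-distribʳ-∑ (∑ ys v) xs u ⟨
    ∑ xs u * ∑ ys v                     ∎

  ∑-allFin-suc : ∀ n (f : Fin (suc n) → Carrier) → ∑ (allFin (suc n)) f ≈ f Fin.zero + ∑[ j ∈ allFin n ] f (Fin.suc j)
  ∑-allFin-suc n f = +-congˡ (begin
    ∑ (tabulate Fin.suc) f         ≡⟨ ≡.cong (λ js → ∑ js f) (map-tabulate id Fin.suc) ⟨
    ∑ (map Fin.suc (allFin n)) f   ≈⟨ ∑-map Fin.suc (allFin n) f ⟩
    ∑[ j ∈ allFin n ] f (Fin.suc j) ∎)

  ∑-allFin-δ : ∀ n (i : Fin n) (f : Fin n → Carrier) → (∀ j → j ≢ i → f j ≈ 0#) → ∑ (allFin n) f ≈ f i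
  ∑-allFin-δ (suc n) Fin.zero f e = begin
    ∑ (allFin (suc n)) f                      ≈⟨ ∑-allFin-suc n f ⟩
    f Fin.zero + ∑[ j ∈ allFin n ] f (Fin.suc j) ≈⟨ +-congˡ (∑-zero (allFin n) (λ j → e (Fin.suc j) λ ())) ⟩
    f Fin.zero + 0#                           ≈⟨ +-identityʳ _ ⟩
    f Fin.zero                                ∎
  ∑-allFin-δ (suc n) (Fin.suc i) f e = begin
    ∑ (allFin (suc n)) f                      ≈⟨ ∑-allFin-suc n f ⟩
    f Fin.zero + ∑[ j ∈ allFin n ] f (Fin.suc j) ≈⟨ +-cong (e Fin.zero λ ())
                                                   (∑-allFin-δ n i (f ∘ Fin.suc) (λ j j≢i → e (Fin.suc j) (j≢i ∘ Fin.suc-injective))) ⟩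
    0# + f (Fin.suc i)                        ≈⟨ +-identityˡ _ ⟩
    f (Fin.suc i)                             ∎

  ⟦∧⟧ : ∀ a b → ⟦ a ∧ b ⟧ ≈ ⟦ a ⟧ * ⟦ b ⟧
  ⟦∧⟧ true  b = sym (*-identityˡ _)
  ⟦∧⟧ false b = sym (zeroˡ _)

  ⟦∧⟧-regroup : ∀ a b c d → ⟦ a ⟧ * ⟦ b ∧ (c ∧ d) ⟧ ≈ ⟦ a ∧ b ⟧ * (⟦ c ⟧ * ⟦ d ⟧)
  ⟦∧⟧-regroup true  true  c d = *-congˡ (⟦∧⟧ c d)
  ⟦∧⟧-regroup true  false c d = trans (*-identityˡ 0#) (sym (zeroˡ _))
  ⟦∧⟧-regroup false b     c d = trans (zeroˡ _) (sym (zeroˡ _))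

  ⟦⟧-* : ∀ b x → ⟦ b ⟧ * x ≈ (if b then x else 0#)
  ⟦⟧-* true  x = *-identityˡ x
  ⟦⟧-* false x = zeroˡ x

  ⟦⟧-*-cong : ∀ b {x y} → (T b → x ≈ y) → ⟦ b ⟧ * x ≈ ⟦ b ⟧ * y
  ⟦⟧-*-cong true  e = *-congˡ (e _)
  ⟦⟧-*-cong false e = trans (zeroˡ _) (sym (zeroˡ _))

  ⟦false⟧-* : ∀ b x → ¬ T b → ⟦ b ⟧ * x ≈ 0#
  ⟦false⟧-* true  x ¬b = ⊥-elim (¬b _)
  ⟦false⟧-* false x ¬b = zeroˡ x

  ⟦⟧-false : ∀ {b} → ¬ T b → ⟦ b ⟧ ≈ 0#
  ⟦⟧-false {true}  ¬b = ⊥-elim (¬b _)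
  ⟦⟧-false {false} ¬b = refl

module Arithmetic where

  open import Data.Bool using (Bool; true; T; not; _∧_)
  open import Data.Bool.Properties using (T-∧; T-≡; ⇔→≡)
  open import Data.Nat using (zero; suc; _+_; _∸_; _≤_; _≡ᵇ_; _≤ᵇ_; _<ᵇ_)
  open import Data.Nat.Properties
  open import Data.Product using (_,_)
  open import Function using (_∘_)
  open import Function.Bundles using (Equivalence; mk⇔)
  open import Relation.Binary.PropositionalEquality

  open import Algebra.Properties.CommutativeSemigroup +-commutativeSemigroup using (interchange)
  open Equivalence using (to; from)

  T-ext : ∀ {a b : Bool} → (T a → T b) → (T b → T a) → a ≡ b
  T-ext f g = ⇔→≡ {z = true} (mk⇔ (to T-≡ ∘ f ∘ from T-≡) (to T-≡ ∘ g ∘ from T-≡))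

  ∸-telescope : ∀ {a b c} → a ≤ b → b ≤ c → (b ∸ a) + (c ∸ b) ≡ c ∸ a
  ∸-telescope {a} {b} {c} a≤b b≤c = begin
    (b ∸ a) + (c ∸ b) ≡⟨ +-comm (b ∸ a) (c ∸ b) ⟩
    (c ∸ b) + (b ∸ a) ≡⟨ +-∸-assoc (c ∸ b) a≤b ⟨
    (c ∸ b) + b ∸ a   ≡⟨ cong (_∸ a) (m∸n+n≡m b≤c) ⟩
    c ∸ a             ∎
    where open ≡-Reasoning

  ∸-distrib-+ : ∀ {a b c d} → a ≤ b → c ≤ d → (b + d) ∸ (a + c) ≡ (b ∸ a) + (d ∸ c)
  ∸-distrib-+ {a} {b} {c} {d} a≤b c≤d = begin
    (b + d) ∸ (a + c)                                 ≡⟨ cong₂ (λ u v → (u + v) ∸ (a + c)) (m+[n∸m]≡n a≤b) (m+[n∸m]≡n c≤d) ⟨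
    ((a + (b ∸ a)) + (c + (d ∸ c))) ∸ (a + c)         ≡⟨ cong (_∸ (a + c)) (interchange a (b ∸ a) c (d ∸ c)) ⟩
    ((a + c) + ((b ∸ a) + (d ∸ c))) ∸ (a + c)         ≡⟨ m+n∸m≡n (a + c) _ ⟩
    (b ∸ a) + (d ∸ c)                                 ∎
    where open ≡-Reasoning

  ≡ᵇ-+ : ∀ e r ℓ → ((e + r) ≡ᵇ ℓ) ≡ ((e ≤ᵇ ℓ) ∧ (r ≡ᵇ (ℓ ∸ e)))
  ≡ᵇ-+ e r ℓ = T-ext split join
    where
    split : T ((e + r) ≡ᵇ ℓ) → T ((e ≤ᵇ ℓ) ∧ (r ≡ᵇ (ℓ ∸ e)))
    split t with ≡ᵇ⇒≡ (e + r) ℓ t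
    ... | refl = from T-∧ (≤⇒≤ᵇ (m≤m+n e r) , ≡⇒≡ᵇ r _ (sym (m+n∸m≡n e r)))
    join : T ((e ≤ᵇ ℓ) ∧ (r ≡ᵇ (ℓ ∸ e))) → T ((e + r) ≡ᵇ ℓ)
    join t with to (T-∧ {e ≤ᵇ ℓ}) t
    ... | e≤ℓ , r≡ with ≡ᵇ⇒≡ r (ℓ ∸ e) r≡
    ... | refl = ≡⇒≡ᵇ _ ℓ (m+[n∸m]≡n (≤ᵇ⇒≤ e ℓ e≤ℓ))

  ≤ᵇ≡<ᵇ-suc : ∀ m n → (m ≤ᵇ n) ≡ (m <ᵇ suc n)
  ≤ᵇ≡<ᵇ-suc zero    n = refl
  ≤ᵇ≡<ᵇ-suc (suc m) n = refl

  ≤ᵇ≡not-<ᵇ : ∀ l m → (l ≤ᵇ m) ≡ not (m <ᵇ l)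
  ≤ᵇ≡not-<ᵇ zero          zero    = refl
  ≤ᵇ≡not-<ᵇ zero          (suc m) = refl
  ≤ᵇ≡not-<ᵇ (suc l)       zero    = refl
  ≤ᵇ≡not-<ᵇ (suc zero)    (suc m) = ≤ᵇ≡not-<ᵇ zero m
  ≤ᵇ≡not-<ᵇ (suc (suc l)) (suc m) = ≤ᵇ≡not-<ᵇ (suc l) m

module Chains (P : FinPoset) where

  open import Data.Bool using (true; false; T)
  open import Data.Bool.ListAction using (all)
  open import Data.Bool.Properties using (T-∧)
  open import Data.Fin using (_≟_)
  open import Data.List using (List; []; _∷_; _++_; drop)
  open import Data.List.Relation.Unary.All as All using (All; []; _∷_)
  open import Data.List.Relation.Unary.AllPairs using ([]; _∷_)
  open import Data.List.Relation.Unary.Unique.Propositional using (Unique)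
  open import Data.Product using (Σ; _×_; _,_; proj₁; proj₂; map₁)
  open import Data.Unit using (tt)
  open import Function using (_∘_)
  open import Function.Bundles using (Equivalence)
  open import Relation.Binary.PropositionalEquality
  open import Relation.Nullary using (contradiction)
  open import Relation.Nullary.Decidable using (isYes≗does; dec-true; dec-false; toWitness)

  open PosetDefs P
  open Equivalence using (to; from)

  eqb-refl : ∀ x → eqb x x ≡ true
  eqb-refl x = trans (isYes≗does (x ≟ x)) (dec-true (x ≟ x) refl)

  eqb-≢ : ∀ {x y} → x ≢ y → eqb x y ≡ false
  eqb-≢ {x} {y} x≢y = trans (isYes≗does (x ≟ y)) (dec-false (x ≟ y) x≢y)

  lt⇒leq : ∀ {x y} → T (lt x y) → T (leq x y)
  lt⇒leq = proj₁ ∘ to T-∧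

  lt⇒≢ : ∀ {x y} → T (lt x y) → x ≢ y
  lt⇒≢ {x} x<x refl rewrite eqb-refl x = proj₂ (to T-∧ x<x)

  leq∧≢⇒lt : ∀ {x y} → T (leq x y) → x ≢ y → T (lt x y)
  leq∧≢⇒lt x≤y x≢y rewrite eqb-≢ x≢y = from T-∧ (x≤y , tt)

  cov⇒lt : ∀ {x y} → T (cov x y) → T (lt x y)
  cov⇒lt = proj₁ ∘ to T-∧

  leq-trans : ∀ {x y z} → T (leq x y) → T (leq y z) → T (leq x z)
  leq-trans = transitive _ _ _

  lt-leq-trans : ∀ {x y z} → T (lt x y) → T (leq y z) → T (lt x z)
  lt-leq-trans {x} {y} x<y y≤z = leq∧≢⇒lt (leq-trans (lt⇒leq x<y) y≤z)
    λ { refl → lt⇒≢ x<y (antisym _ _ (lt⇒leq x<y) y≤z) }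

  data SatChain : El → List El → El → Set where
    done : ∀ {a} → SatChain a (a ∷ []) a
    step : ∀ {a y r b} → T (cov a y) → SatChain y (y ∷ r) b → SatChain a (a ∷ y ∷ r) b

  SatChain⇒satFromTo : ∀ {a c b} → SatChain a c b → T (satFromTo c a b)
  SatChain⇒satFromTo {b = b} h = from T-∧ (first h , from T-∧ (last h , covers h))
    where
    first : ∀ {x c} → SatChain x c b → T (headIs x c)
    first {x} done       = subst T (sym (eqb-refl x)) tt
    first {x} (step _ _) = subst T (sym (eqb-refl x)) tt
    last : ∀ {x c} → SatChain x c b → T (lastIs b c)
    last done       = subst T (sym (eqb-refl b)) tt
    last (step _ h) = last h
    covers : ∀ {x c} → SatChain x c b → T (all (λ p → cov (proj₁ p) (proj₂ p)) (consec c))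
    covers done         = tt
    covers (step x⋖y h) = from T-∧ (x⋖y , covers h)

  satFromTo⇒SatChain : ∀ {a c b} → T (satFromTo c a b) → SatChain a c b
  satFromTo⇒SatChain {a} {x ∷ r} {b} s with to T-∧ s
  ... | a≡x , s′ with toWitness {a? = a ≟ x} a≡x
  ... | refl with to T-∧ s′
  ... | last , covers = chain r last covers
    where
    chain : ∀ {x} r → T (lastIs b (x ∷ r)) → T (all (λ p → cov (proj₁ p) (proj₂ p)) (consec (x ∷ r))) → SatChain x (x ∷ r) b
    chain {x} []      b≡x _      with toWitness {a? = b ≟ x} b≡x
    ... | refl = done
    chain (y ∷ r) last covers = step (proj₁ (to T-∧ covers)) (chain r last (proj₂ (to T-∧ covers)))

  chain-leq : ∀ {a c b} → SatChain a c b → T (leq a b)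
  chain-leq {a} done       = reflexive a
  chain-leq (step a⋖y h) = leq-trans (lt⇒leq (cov⇒lt a⋖y)) (chain-leq h)

  chain-lt : ∀ {a y r b} → SatChain a (a ∷ y ∷ r) b → T (lt a b)
  chain-lt (step a⋖y h) = lt-leq-trans (cov⇒lt a⋖y) (chain-leq h)

  chain-trivial : ∀ {a c} → SatChain a c a → c ≡ a ∷ []
  chain-trivial done         = refl
  chain-trivial h@(step _ _) = contradiction refl (lt⇒≢ (chain-lt h))

  chain-within : ∀ {a c b} → SatChain a c b → All (λ z → T (leq a z) × T (leq z b)) c
  chain-within {a} done           = (reflexive a , reflexive a) ∷ []
  chain-within {a} h@(step a⋖y h′) =
    (reflexive a , chain-leq h) ∷ All.map (map₁ (leq-trans (lt⇒leq (cov⇒lt a⋖y)))) (chain-within h′)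

  chain-above-head : ∀ {a r b} → SatChain a (a ∷ r) b → All (λ z → T (lt a z)) r
  chain-above-head done           = []
  chain-above-head (step a⋖y h) = cov⇒lt a⋖y ∷ All.map (lt-leq-trans (cov⇒lt a⋖y) ∘ lt⇒leq) (chain-above-head h)

  chain-∷ʳ : ∀ {a c x y} → SatChain a c x → T (cov x y) → SatChain a (c ++ y ∷ []) y
  chain-∷ʳ done         x⋖y = step x⋖y done
  chain-∷ʳ (step a⋖z h) x⋖y = step a⋖z (chain-∷ʳ h x⋖y)

  chain-++ : ∀ {a A m B b} → SatChain a A m → SatChain m (m ∷ B) b → SatChain a (A ++ B) b
  chain-++ done         h = h
  chain-++ (step a⋖y g) h = step a⋖y (chain-++ g h)

  chain-split : ∀ {a b} x A B → SatChain a (x ∷ A ++ B) b → Σ El λ m → SatChain a (x ∷ A) m × SatChain m (m ∷ B) b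
  chain-split x []      B h@done       = x , done , h
  chain-split x []      B h@(step _ _) = x , done , h
  chain-split x (y ∷ A) B (step x⋖y h) with chain-split y A B h
  ... | m , g , g′ = m , step x⋖y g , g′

  above-chain-≢-head : ∀ {a y r c p} → SatChain a (a ∷ y ∷ r) c → T (leq c p) → p ≢ a
  above-chain-≢-head g c≤p refl = lt⇒≢ (chain-lt g) (antisym _ _ (lt⇒leq (chain-lt g)) c≤p)

  chain-∷ : ∀ {a c b} → SatChain a c b → a ∷ drop 1 c ≡ c
  chain-∷ done       = refl
  chain-∷ (step _ _) = refl

  chain-unique : ∀ {a c b} → SatChain a c b → Unique c
  chain-unique done           = All.[] ∷ []
  chain-unique g@(step _ g′) = All.map lt⇒≢ (chain-above-head g) ∷ chain-unique g′

module GradedChains (P : FinPoset) (G : IsGraded P)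
  (saturated : ∀ {x y} → T (PosetDefs.leq P x y) → Σ (List (PosetDefs.El P)) λ c → Chains.SatChain P x c y) where

  open import Data.Fin using (Fin; toℕ; _≟_)
  import Data.Fin.Properties as Fin
  open import Data.List using ([]; _∷_; _++_; length; lookup)
  open import Data.List.Properties using (length-++)
  open import Data.Nat using (zero; suc; _+_; _∸_; _≤_; _<_)
  open import Data.Nat.Properties hiding (_≟_)
  open import Data.Product using (_,_; proj₂)
  open import Relation.Binary.PropositionalEquality
  open import Relation.Nullary using (contradiction; yes; no)

  open PosetDefs P
  open IsGraded G
  open Arithmetic
  open Chains P

  length-chain-from-bot : ∀ {c x} → SatChain bot c x → length c ≡ suc (rank x)
  length-chain-from-bot {c} {x} h = graded x c (SatChain⇒satFromTo h)

  rank-bot : rank bot ≡ 0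
  rank-bot = suc-injective (sym (length-chain-from-bot done))

  rank-cov : ∀ {x y} → T (cov x y) → rank y ≡ suc (rank x)
  rank-cov {x} {y} x⋖y with saturated (bot-min x)
  ... | c , h = suc-injective (begin
    suc (rank y)            ≡⟨ length-chain-from-bot (chain-∷ʳ h x⋖y) ⟨
    length (c ++ y ∷ [])    ≡⟨ length-++ c ⟩
    length c + 1            ≡⟨ +-comm (length c) 1 ⟩
    suc (length c)          ≡⟨ cong suc (length-chain-from-bot h) ⟩
    suc (suc (rank x))      ∎)
    where open ≡-Reasoning

  rank-+-length : ∀ {a c b} → SatChain a c b → rank a + length c ≡ suc (rank b)
  rank-+-length {a} done = +-comm (rank a) 1
  rank-+-length {a} (step {y = y} {r = r} a⋖y h) = begin
    rank a + suc (length (y ∷ r))  ≡⟨ +-suc (rank a) _ ⟩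
    suc (rank a) + length (y ∷ r)  ≡⟨ cong (_+ length (y ∷ r)) (rank-cov a⋖y) ⟨
    rank y + length (y ∷ r)        ≡⟨ rank-+-length h ⟩
    suc (rank _)                   ∎
    where open ≡-Reasoning

  chain-rank-mono : ∀ {a c b} → SatChain a c b → rank a ≤ rank b
  chain-rank-mono done                 = ≤-refl
  chain-rank-mono {b = b} (step a⋖y h) = ≤-trans (n≤1+n _) (subst (_≤ rank b) (rank-cov a⋖y) (chain-rank-mono h))

  rank-mono : ∀ {x y} → T (leq x y) → rank x ≤ rank y
  rank-mono x≤y = chain-rank-mono (proj₂ (saturated x≤y))

  rank-strict : ∀ {x y} → T (lt x y) → rank x < rank y
  rank-strict {y = y} x<y with saturated (lt⇒leq x<y)
  ... | _ , done       = contradiction refl (lt⇒≢ x<y)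
  ... | _ , step x⋖z h = subst (_≤ rank y) (rank-cov x⋖z) (chain-rank-mono h)

  leq-rank-≡ : ∀ {x y} → T (leq x y) → rank x ≡ rank y → x ≡ y
  leq-rank-≡ {x} {y} x≤y rx≡ry with x ≟ y
  ... | yes x≡y = x≡y
  ... | no  x≢y = contradiction rx≡ry (<⇒≢ (rank-strict (leq∧≢⇒lt x≤y x≢y)))

  rank<N : ∀ x → rank x < N
  rank<N x with saturated (bot-min x)
  ... | c , h = subst (_≤ N) (length-chain-from-bot h) (Fin.injective⇒≤ lookup-injective)
    where
    rank-lookup : ∀ {a c b} → SatChain a c b → ∀ i → rank (lookup c i) ≡ rank a + toℕ i
    rank-lookup {a} done         Fin.zero    = sym (+-identityʳ (rank a))
    rank-lookup {a} (step _ _)   Fin.zero    = sym (+-identityʳ (rank a))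
    rank-lookup {a} (step {y = y} {r = r} a⋖y h) (Fin.suc i) = begin
      rank (lookup (y ∷ r) i) ≡⟨ rank-lookup h i ⟩
      rank y + toℕ i        ≡⟨ cong (_+ toℕ i) (rank-cov a⋖y) ⟩
      suc (rank a) + toℕ i  ≡⟨ +-suc (rank a) (toℕ i) ⟨
      rank a + suc (toℕ i)  ∎
      where open ≡-Reasoning
    lookup-injective : ∀ {i j} → lookup c i ≡ lookup c j → i ≡ j
    lookup-injective {i} {j} ci≡cj = Fin.toℕ-injective (+-cancelˡ-≡ (rank bot) _ _
      (trans (sym (rank-lookup h i)) (trans (cong rank ci≡cj) (rank-lookup h j))))

  rank-∸-cov : ∀ {a y z} → T (cov a y) → T (leq y z) → rank z ∸ rank a ≡ suc (rank z ∸ rank y)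
  rank-∸-cov {a} {y} {z} a⋖y y≤z = begin
    rank z ∸ rank a                       ≡⟨ ∸-telescope (rank-mono (lt⇒leq (cov⇒lt a⋖y))) (rank-mono y≤z) ⟨
    (rank y ∸ rank a) + (rank z ∸ rank y) ≡⟨ cong (λ r → (r ∸ rank a) + (rank z ∸ rank y)) (rank-cov a⋖y) ⟩
    (suc (rank a) ∸ rank a) + (rank z ∸ rank y) ≡⟨ cong (_+ (rank z ∸ rank y)) (m+n∸n≡m 1 (rank a)) ⟩
    suc (rank z ∸ rank y)                 ∎
    where open ≡-Reasoning

  length-chain : ∀ {a c b} → SatChain a c b → length c ≡ suc (rank b ∸ rank a)
  length-chain {a} {c} {b} h = +-cancelˡ-≡ (rank a) _ _ (begin
    rank a + length c              ≡⟨ rank-+-length h ⟩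
    suc (rank b)                   ≡⟨ cong suc (m+[n∸m]≡n (rank-mono (chain-leq h))) ⟨
    suc (rank a + (rank b ∸ rank a)) ≡⟨ +-suc (rank a) _ ⟨
    rank a + suc (rank b ∸ rank a) ∎)
    where open ≡-Reasoning

module Segments (P : FinPoset) (G : IsGraded P) (lab : PosetDefs.El P → PosetDefs.El P → ℕ) where

  open import Data.Bool using (Bool; true; false; T; _∧_)
  open import Data.Bool.ListAction using (all)
  open import Data.Bool.Properties using (∧-commutativeMonoid)
  open import Data.List using (List; []; _∷_; _++_; zip)
  open import Data.List.Membership.Propositional using (_∈_)
  open import Data.List.Relation.Unary.All as All using (All; []; _∷_)
  import Data.List.Relation.Unary.Any as Any
  open import Data.List.Relation.Unary.Any.Properties using (any⁺; any⁻)
  open import Data.Product using (proj₁; proj₂)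
  open import Function using (_∘_)
  open import Relation.Binary.PropositionalEquality
  open import Relation.Nullary.Decidable using (toWitness; fromWitness)

  open import Algebra.Solver.CommutativeMonoid ∧-commutativeMonoid using (solve; _⊜_; _⊕_)
  open GradedDefs P G
  open Labels lab
  open Chains P

  ∈⇒memb : ∀ {z M} → z ∈ M → T (memb z M)
  ∈⇒memb {z} = any⁺ (eqb z) ∘ Any.map (λ { refl → fromWitness refl })

  memb⇒∈ : ∀ {z M} → T (memb z M) → z ∈ M
  memb⇒∈ {z} {M} = Any.map toWitness ∘ any⁻ (eqb z) M

  dropTo-head : ∀ s M → dropTo s (s ∷ M) ≡ s ∷ M
  dropTo-head s M rewrite eqb-refl s = refl

  dropTo-∷ : ∀ {z y} M → z ≢ y → dropTo z (y ∷ M) ≡ dropTo z M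
  dropTo-∷ M z≢y rewrite eqb-≢ z≢y = refl

  seg-head : ∀ y M → seg y y (y ∷ M) ≡ y ∷ []
  seg-head y M rewrite eqb-refl y | eqb-refl y = refl

  seg-∷ : ∀ {z y} M → z ≢ y → seg y z (y ∷ M) ≡ y ∷ takeTo z M
  seg-∷ {z} {y} M z≢y rewrite eqb-refl y | eqb-≢ z≢y = refl

  labs-∷-takeTo : ∀ a y z r → labs (a ∷ takeTo z (y ∷ r)) ≡ lab a y ∷ labs (seg y z (y ∷ r))
  labs-∷-takeTo a y z r rewrite eqb-refl y with eqb z y
  ... | true  = refl
  ... | false = refl

  incDecFrom : El → List El → List El → List El → Bool
  incDecFrom s C D M =
    all (λ a → memb a M) C ∧ all (λ a → memb a M) D ∧
    all (λ p → strictDec (labs (seg (proj₁ p) (proj₂ p) M))) (zip C D) ∧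
    all (λ p → weakInc (labs (seg (proj₁ p) (proj₂ p) M))) (incPairs s C D)

  incDecFrom-∷ : ∀ s c d cs ds M → incDecFrom s (c ∷ cs) (d ∷ ds) M ≡
    memb c M ∧ (weakInc (labs (seg s c M)) ∧ (memb d M ∧ (strictDec (labs (seg c d M)) ∧ incDecFrom d cs ds M)))
  incDecFrom-∷ s c d cs ds M = regroup (memb c M) (all (λ a → memb a M) cs) (memb d M) (all (λ a → memb a M) ds)
    (strictDec (labs (seg c d M))) (all (λ p → strictDec (labs (seg (proj₁ p) (proj₂ p) M))) (zip cs ds))
    (weakInc (labs (seg s c M))) (all (λ p → weakInc (labs (seg (proj₁ p) (proj₂ p) M))) (incPairs d cs ds))
    where
    regroup : ∀ mc acs md ads sd azip wi ainc →
      (mc ∧ acs) ∧ ((md ∧ ads) ∧ ((sd ∧ azip) ∧ (wi ∧ ainc))) ≡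
      mc ∧ (wi ∧ (md ∧ (sd ∧ (acs ∧ (ads ∧ (azip ∧ ainc))))))
    regroup = solve 8 (λ mc acs md ads sd azip wi ainc →
      ((mc ⊕ acs) ⊕ ((md ⊕ ads) ⊕ ((sd ⊕ azip) ⊕ (wi ⊕ ainc)))) ⊜
      (mc ⊕ (wi ⊕ (md ⊕ (sd ⊕ (acs ⊕ (ads ⊕ (azip ⊕ ainc)))))))) refl

  private
    all-cong : ∀ {X : Set} {p q : X → Bool} {xs} → All (λ x → p x ≡ q x) xs → all p xs ≡ all q xs
    all-cong []         = refl
    all-cong (e ∷ es) = cong₂ _∧_ e (all-cong es)

    zip-sources : ∀ {Q : El → Set} {cs ds : List El} → All Q cs → All (Q ∘ proj₁) (zip cs ds)
    zip-sources {ds = []}     []       = []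
    zip-sources {ds = []}     (_ ∷ _)  = []
    zip-sources {ds = _ ∷ _}  []       = []
    zip-sources {ds = _ ∷ ds} (q ∷ qs) = q ∷ zip-sources qs

    incPairs-sources : ∀ {Q : El → Set} {s cs ds} → Q s → All Q ds → All (Q ∘ proj₁) (incPairs s cs ds)
    incPairs-sources {cs = []}    q _         = q ∷ []
    incPairs-sources {cs = _ ∷ _} q []        = []
    incPairs-sources {cs = _ ∷ _} q (q′ ∷ qs) = q ∷ incPairs-sources q′ qs

  -- No element ≥ c occurs in A except its last entry c.
  module _ {s A c} (h : SatChain s A c) (B : List El) where

    dropTo-++ : ∀ p → T (leq c p) → dropTo p (A ++ B) ≡ dropTo p (c ∷ B)
    dropTo-++ p c≤p = go h
      where
      go : ∀ {a A} → SatChain a A c → dropTo p (A ++ B) ≡ dropTo p (c ∷ B)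
      go done                           = refl
      go g@(step _ g′) rewrite eqb-≢ (above-chain-≢-head g c≤p) = go g′

    memb-++ : ∀ p → T (leq c p) → memb p (A ++ B) ≡ memb p (c ∷ B)
    memb-++ p c≤p = go h
      where
      go : ∀ {a A} → SatChain a A c → memb p (A ++ B) ≡ memb p (c ∷ B)
      go done                           = refl
      go g@(step _ g′) rewrite eqb-≢ (above-chain-≢-head g c≤p) = go g′

    takeTo-++ : takeTo c (A ++ B) ≡ A
    takeTo-++ = go h
      where
      go : ∀ {a A} → SatChain a A c → takeTo c (A ++ B) ≡ A
      go done rewrite eqb-refl c = refl
      go {a} g@(step _ g′) rewrite eqb-≢ (above-chain-≢-head g (reflexive c)) = cong (a ∷_) (go g′)

    seg-++ : seg s c (A ++ B) ≡ A
    seg-++ = trans (cong (takeTo c) (from-head h)) takeTo-++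
      where
      from-head : ∀ {a A} → SatChain a A c → dropTo a (A ++ B) ≡ A ++ B
      from-head done       = dropTo-head c B
      from-head (step _ _) = dropTo-head _ _

    seg-++-above : ∀ p q → T (leq c p) → seg p q (A ++ B) ≡ seg p q (c ∷ B)
    seg-++-above p q c≤p = cong (takeTo q) (dropTo-++ p c≤p)

    private
      segs-++ : ∀ (f : List ℕ → Bool) {ps} → All (λ p → T (leq c (proj₁ p))) ps →
        all (λ p → f (labs (seg (proj₁ p) (proj₂ p) (A ++ B)))) ps ≡ all (λ p → f (labs (seg (proj₁ p) (proj₂ p) (c ∷ B)))) ps
      segs-++ f = all-cong ∘ All.map (λ {p} c≤p → cong (f ∘ labs) (seg-++-above (proj₁ p) (proj₂ p) c≤p))

    incDecFrom-++ : ∀ {s′ cs ds} → T (leq c s′) → All (λ y → T (leq c y)) cs → All (λ y → T (leq c y)) ds →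
      incDecFrom s′ cs ds (A ++ B) ≡ incDecFrom s′ cs ds (c ∷ B)
    incDecFrom-++ {cs = cs} c≤s′ c≤cs c≤ds =
      cong₂ _∧_ (all-cong (All.map (memb-++ _) c≤cs)) (cong₂ _∧_ (all-cong (All.map (memb-++ _) c≤ds))
        (cong₂ _∧_ (segs-++ strictDec (zip-sources c≤cs)) (segs-++ weakInc (incPairs-sources {cs = cs} c≤s′ c≤ds))))

module Counting (P : FinPoset) (G : IsGraded P) (lab : PosetDefs.El P → PosetDefs.El P → ℕ) (RL : GradedDefs.IsRLabeling P G lab) where

  open import Data.Bool using (Bool; false; T; _∧_)
  open import Data.Bool.Properties using (T-∧; T-≡; ∧-identityʳ)
  open import Data.List using (List; []; _∷_; _++_; length; map; drop; filterᵇ)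
  open import Data.List.Membership.Propositional using (_∈_)
  open import Data.List.Properties using (∷-injectiveˡ; ∷-injectiveʳ; ++-identityʳ)
  import Data.List.Relation.Unary.All as All
  open import Data.List.Relation.Unary.All.Properties using (++⁺)
  open import Data.List.Relation.Unary.Any using (here; there)
  open import Data.Nat using (zero; suc; _+_; _*_; _∸_)
  open import Data.Nat.Properties
  open import Data.Nat.Tactic.RingSolver using (solve-∀)
  open import Data.Product using (Σ; _×_; _,_; proj₁; proj₂)
  open import Data.Sum using (_⊎_; inj₁; inj₂)
  open import Function using (_∘_)
  open import Function.Bundles using (Equivalence)
  open import Relation.Binary.PropositionalEquality

  open GradedDefs P G
  open Labels lab
  open IsRLabeling RL
  open Arithmetic
  open Chains P
  open Segments P G lab
  open ListSum +-*-commutativeSemiring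
  open Equivalence using (to; from)

  saturated : ∀ {x y} → T (leq x y) → Σ (List El) λ c → SatChain x c y
  saturated {x} {y} x≤y with unique-inc x y x≤y
  ... | c , s , _ = c , satFromTo⇒SatChain (proj₁ (to T-∧ s))

  open GradedChains P G saturated

  chainSize : El → El → ℕ
  chainSize a b = suc (rank b ∸ rank a)

  ∑-lists-∷ : ∀ k (F : List El → ℕ) → ∑ (lists (suc k)) F ≡ ∑[ x ∈ elems ] ∑[ B ∈ lists k ] F (x ∷ B)
  ∑-lists-∷ k F = trans (∑-concatMap _ elems F) (∑-cong elems λ x → ∑-map (x ∷_) (lists k) F)

  ∑-lists-++ : ∀ j k (F : List El → ℕ) → ∑ (lists (j + k)) F ≡ ∑[ A ∈ lists j ] ∑[ B ∈ lists k ] F (A ++ B)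
  ∑-lists-++ zero    k F = sym (+-identityʳ _)
  ∑-lists-++ (suc j) k F = begin
    ∑ (lists (suc (j + k))) F                                      ≡⟨ ∑-lists-∷ (j + k) F ⟩
    ∑[ x ∈ elems ] ∑[ B ∈ lists (j + k) ] F (x ∷ B)                ≡⟨ ∑-cong elems (λ x → ∑-lists-++ j k (F ∘ (x ∷_))) ⟩
    ∑[ x ∈ elems ] ∑[ A ∈ lists j ] ∑[ B ∈ lists k ] F (x ∷ A ++ B) ≡⟨ ∑-lists-∷ j _ ⟨
    ∑[ A ∈ lists (suc j) ] ∑[ B ∈ lists k ] F (A ++ B)             ∎
    where open ≡-Reasoning

  ∑-lists-cong : ∀ m {F F′ : List El → ℕ} → (∀ A → length A ≡ m → F A ≡ F′ A) → ∑ (lists m) F ≡ ∑ (lists m) F′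
  ∑-lists-cong zero    e = cong (_+ 0) (e [] refl)
  ∑-lists-cong (suc m) {F} {F′} e = begin
    ∑ (lists (suc m)) F                      ≡⟨ ∑-lists-∷ m F ⟩
    ∑[ x ∈ elems ] ∑[ B ∈ lists m ] F (x ∷ B)  ≡⟨ ∑-cong elems (λ x → ∑-lists-cong m (λ B → e (x ∷ B) ∘ cong suc)) ⟩
    ∑[ x ∈ elems ] ∑[ B ∈ lists m ] F′ (x ∷ B) ≡⟨ ∑-lists-∷ m F′ ⟨
    ∑ (lists (suc m)) F′                     ∎
    where open ≡-Reasoning

  ∑-lists-δ : ∀ {m} c → length c ≡ m → (F : List El → ℕ) → (∀ A → A ≢ c → F A ≡ 0) → ∑ (lists m) F ≡ F c
  ∑-lists-δ {zero}  []      _  F e = +-identityʳ (F [])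
  ∑-lists-δ {suc m} (x ∷ c) ∣c∣ F e = begin
    ∑ (lists (suc m)) F                       ≡⟨ ∑-lists-∷ m F ⟩
    ∑[ y ∈ elems ] ∑[ B ∈ lists m ] F (y ∷ B) ≡⟨ ∑-allFin-δ N x _ (λ y y≢x →
                                                   ∑-zero (lists m) (λ B → e (y ∷ B) (y≢x ∘ ∷-injectiveˡ))) ⟩
    ∑[ B ∈ lists m ] F (x ∷ B)                ≡⟨ ∑-lists-δ c (suc-injective ∣c∣) (F ∘ (x ∷_))
                                                   (λ B B≢c → e (x ∷ B) (B≢c ∘ ∷-injectiveʳ)) ⟩
    F (x ∷ c)                                 ∎
    where open ≡-Reasoning

  satFromTo-through : ∀ {s c t} → T (leq s c) → ∀ A B → length A ≡ chainSize s c →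
    (satFromTo (A ++ B) s t ∧ memb c (A ++ B)) ≡ (satFromTo A s c ∧ satFromTo (c ∷ B) c t)
  satFromTo-through {s} {c} {t} s≤c (x ∷ A) B ∣A∣ = T-ext split join
    where
    split : T (satFromTo (x ∷ A ++ B) s t ∧ memb c (x ∷ A ++ B)) → T (satFromTo (x ∷ A) s c ∧ satFromTo (c ∷ B) c t)
    split sat∧c∈ with to (T-∧ {satFromTo (x ∷ A ++ B) s t}) sat∧c∈
    ... | sat , c∈ with chain-split x A B (satFromTo⇒SatChain sat)
    ... | m , g , g′ with c≡m
      where
      rank-m : rank m ≡ rank c
      rank-m = ∸-cancelʳ-≡ (chain-rank-mono g) (rank-mono s≤c) (suc-injective (trans (sym (length-chain g)) ∣A∣))
      comparable : All.All (λ z → T (leq z m) ⊎ T (leq m z)) (x ∷ A ++ B)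
      comparable = ++⁺ (All.map (inj₁ ∘ proj₂) (chain-within g)) (All.map (inj₂ ∘ proj₁) (All.tail (chain-within g′)))
      c≡m : c ≡ m
      c≡m with All.lookup comparable (memb⇒∈ c∈)
      ... | inj₁ c≤m = leq-rank-≡ c≤m (sym rank-m)
      ... | inj₂ m≤c = sym (leq-rank-≡ m≤c rank-m)
    ... | refl = from (T-∧ {satFromTo (x ∷ A) s m}) (SatChain⇒satFromTo g , SatChain⇒satFromTo g′)
    join : T (satFromTo (x ∷ A) s c ∧ satFromTo (c ∷ B) c t) → T (satFromTo (x ∷ A ++ B) s t ∧ memb c (x ∷ A ++ B))
    join sat∧sat with to (T-∧ {satFromTo (x ∷ A) s c}) sat∧sat
    ... | sat , sat′ = from (T-∧ {satFromTo (x ∷ A ++ B) s t})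
      (SatChain⇒satFromTo (chain-++ g (satFromTo⇒SatChain {c} {c ∷ B} {t} sat′)) , ∈⇒memb (last∈ g))
      where
      g : SatChain s (x ∷ A) c
      g = satFromTo⇒SatChain sat
      last∈ : ∀ {a A} → SatChain a A c → c ∈ A ++ B
      last∈ done        = here refl
      last∈ (step _ g′) = there (last∈ g′)

  satFromTo-head≢ : ∀ {x c t} B → x ≢ c → satFromTo (x ∷ B) c t ≡ false
  satFromTo-head≢ B x≢c rewrite eqb-≢ (x≢c ∘ sym) = refl

  ∑-chains-through : ∀ {s c t} → T (leq s c) → T (leq c t) → (h : List El → ℕ) →
    ∑[ M ∈ lists (chainSize s t) ] (⟦ satFromTo M s t ∧ memb c M ⟧ * h M) ≡
    ∑[ A ∈ lists (chainSize s c) ] (⟦ satFromTo A s c ⟧ * ∑[ B ∈ lists (chainSize c t) ] (⟦ satFromTo B c t ⟧ * h (A ++ drop 1 B)))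
  ∑-chains-through {s} {c} {t} s≤c c≤t h = begin
    ∑[ M ∈ lists (chainSize s t) ] (⟦ satFromTo M s t ∧ memb c M ⟧ * h M)
      ≡⟨ cong (λ n → ∑[ M ∈ lists n ] (⟦ satFromTo M s t ∧ memb c M ⟧ * h M)) size ⟨
    ∑[ M ∈ lists (chainSize s c + k) ] (⟦ satFromTo M s t ∧ memb c M ⟧ * h M)
      ≡⟨ ∑-lists-++ (chainSize s c) k _ ⟩
    ∑[ A ∈ lists (chainSize s c) ] ∑[ B ∈ lists k ] (⟦ satFromTo (A ++ B) s t ∧ memb c (A ++ B) ⟧ * h (A ++ B))
      ≡⟨ ∑-lists-cong (chainSize s c) (λ A ∣A∣ → ∑-cong (lists k) (λ B →
           cong (λ b → ⟦ b ⟧ * h (A ++ B)) (satFromTo-through s≤c A B ∣A∣))) ⟩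
    ∑[ A ∈ lists (chainSize s c) ] ∑[ B ∈ lists k ] (⟦ satFromTo A s c ∧ satFromTo (c ∷ B) c t ⟧ * h (A ++ B))
      ≡⟨ ∑-cong (lists (chainSize s c)) (λ A → trans (∑-cong (lists k) (λ B → trans
           (cong (_* h (A ++ B)) (⟦∧⟧ (satFromTo A s c) _)) (*-assoc ⟦ satFromTo A s c ⟧ _ _)))
           (sym (*-distribˡ-∑ ⟦ satFromTo A s c ⟧ (lists k) _))) ⟩
    ∑[ A ∈ lists (chainSize s c) ] (⟦ satFromTo A s c ⟧ * ∑[ B ∈ lists k ] (⟦ satFromTo (c ∷ B) c t ⟧ * h (A ++ B)))
      ≡⟨ ∑-cong (lists (chainSize s c)) (λ A → cong (⟦ satFromTo A s c ⟧ *_) (sym (through-c A))) ⟩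
    ∑[ A ∈ lists (chainSize s c) ] (⟦ satFromTo A s c ⟧ * ∑[ B ∈ lists (chainSize c t) ] (⟦ satFromTo B c t ⟧ * h (A ++ drop 1 B)))
      ∎
    where
    open ≡-Reasoning
    k = rank t ∸ rank c
    size : chainSize s c + k ≡ chainSize s t
    size = cong suc (∸-telescope (rank-mono s≤c) (rank-mono c≤t))
    through-c : ∀ A → ∑[ B ∈ lists (chainSize c t) ] (⟦ satFromTo B c t ⟧ * h (A ++ drop 1 B)) ≡
                      ∑[ B ∈ lists k ] (⟦ satFromTo (c ∷ B) c t ⟧ * h (A ++ B))
    through-c A = trans (∑-lists-∷ k _) (∑-allFin-δ N c _ (λ x x≢c → ∑-zero (lists k) (λ B →
      cong (λ b → ⟦ b ⟧ * h (A ++ B)) (satFromTo-head≢ B x≢c))))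

  #chains : (List ℕ → Bool) → El → El → ℕ
  #chains F a b = ∑[ A ∈ lists (chainSize a b) ] (⟦ satFromTo A a b ⟧ * ⟦ F (labs A) ⟧)

  #chains-weakInc≡1 : ∀ {a b} → T (leq a b) → #chains weakInc a b ≡ 1
  #chains-weakInc≡1 {a} {b} a≤b with unique-inc a b a≤b
  ... | c , inc , unique = begin
    ∑[ A ∈ lists (chainSize a b) ] (⟦ satFromTo A a b ⟧ * ⟦ weakInc (labs A) ⟧)
      ≡⟨ ∑-cong (lists (chainSize a b)) (λ A → sym (⟦∧⟧ (satFromTo A a b) _)) ⟩
    ∑[ A ∈ lists (chainSize a b) ] ⟦ satFromTo A a b ∧ weakInc (labs A) ⟧
      ≡⟨ ∑-lists-δ c (length-chain (satFromTo⇒SatChain {a} {c} {b} (proj₁ (to (T-∧ {satFromTo c a b}) inc)))) _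
           (λ A A≢c → ⟦⟧-false (A≢c ∘ unique A)) ⟩
    ⟦ satFromTo c a b ∧ weakInc (labs c) ⟧
      ≡⟨ cong ⟦_⟧ (to T-≡ inc) ⟩
    1 ∎
    where open ≡-Reasoning

  ∑-chains-factor : ∀ {s c t} → T (leq s c) → T (leq c t) → (F : List ℕ → Bool) (Q : List El → Bool) →
    (∀ {A B} → SatChain s A c → SatChain c (c ∷ B) t → Q (A ++ B) ≡ Q (c ∷ B)) →
    ∑[ M ∈ lists (chainSize s t) ] (⟦ satFromTo M s t ∧ memb c M ⟧ * (⟦ F (labs (seg s c M)) ⟧ * ⟦ Q M ⟧)) ≡
    #chains F s c * ∑[ B ∈ lists (chainSize c t) ] (⟦ satFromTo B c t ⟧ * ⟦ Q B ⟧)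
  ∑-chains-factor {s} {c} {t} s≤c c≤t F Q Q-local = begin
    ∑[ M ∈ lists (chainSize s t) ] (⟦ satFromTo M s t ∧ memb c M ⟧ * (⟦ F (labs (seg s c M)) ⟧ * ⟦ Q M ⟧))
      ≡⟨ ∑-chains-through s≤c c≤t _ ⟩
    ∑[ A ∈ As ] (⟦ satFromTo A s c ⟧ *
      ∑[ B ∈ Bs ] (⟦ satFromTo B c t ⟧ * (⟦ F (labs (seg s c (A ++ drop 1 B))) ⟧ * ⟦ Q (A ++ drop 1 B) ⟧)))
      ≡⟨ ∑-cong As (λ A → ⟦⟧-*-cong (satFromTo A s c) λ satA → ∑-cong Bs λ B → ⟦⟧-*-cong (satFromTo B c t) λ satB →
           local (satFromTo⇒SatChain satA) (satFromTo⇒SatChain {c} {B} {t} satB)) ⟩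
    ∑[ A ∈ As ] (⟦ satFromTo A s c ⟧ * ∑[ B ∈ Bs ] (⟦ satFromTo B c t ⟧ * (⟦ F (labs A) ⟧ * ⟦ Q B ⟧)))
      ≡⟨ ∑-cong As (λ A → trans (*-distribˡ-∑ ⟦ satFromTo A s c ⟧ Bs _) (∑-cong Bs (λ B →
           rearrange ⟦ satFromTo A s c ⟧ ⟦ satFromTo B c t ⟧ ⟦ F (labs A) ⟧ ⟦ Q B ⟧))) ⟩
    ∑[ A ∈ As ] ∑[ B ∈ Bs ] ((⟦ satFromTo A s c ⟧ * ⟦ F (labs A) ⟧) * (⟦ satFromTo B c t ⟧ * ⟦ Q B ⟧))
      ≡⟨ ∑-separable As Bs _ _ ⟩
    #chains F s c * ∑[ B ∈ Bs ] (⟦ satFromTo B c t ⟧ * ⟦ Q B ⟧)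
      ∎
    where
    open ≡-Reasoning
    As = lists (chainSize s c)
    Bs = lists (chainSize c t)
    rearrange : ∀ x y u v → x * (y * (u * v)) ≡ (x * u) * (y * v)
    rearrange = solve-∀
    local : ∀ {A B} → SatChain s A c → SatChain c B t →
      ⟦ F (labs (seg s c (A ++ drop 1 B))) ⟧ * ⟦ Q (A ++ drop 1 B) ⟧ ≡ ⟦ F (labs A) ⟧ * ⟦ Q B ⟧
    local {A} {B} gA gB = cong₂ _*_ (cong (⟦_⟧ ∘ F ∘ labs) (seg-++ gA (drop 1 B)))
      (cong ⟦_⟧ (trans (Q-local gA (subst (λ L → SatChain c L t) (sym (chain-∷ gB)) gB)) (cong Q (chain-∷ gB))))

  #incDecFrom : El → List El → List El → ℕ
  #incDecFrom s C D = ∑[ M ∈ lists (chainSize s top) ] (⟦ satFromTo M s top ⟧ * ⟦ incDecFrom s C D M ⟧)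

  #incDecFrom-[] : ∀ s → #incDecFrom s [] [] ≡ 1
  #incDecFrom-[] s = trans (∑-cong (lists (chainSize s top)) λ M → ⟦⟧-*-cong (satFromTo M s top) λ sat →
      cong ⟦_⟧ (trans (∧-identityʳ (weakInc (labs (seg s top M))))
                      (cong (weakInc ∘ labs) (seg-whole (satFromTo⇒SatChain {s} {M} {top} sat)))))
    (#chains-weakInc≡1 (top-max s))
    where
    seg-whole : ∀ {M} → SatChain s M top → seg s top M ≡ M
    seg-whole {M} g = trans (cong (seg s top) (sym (++-identityʳ M))) (seg-++ g [])

  #incDecFrom-∷ : ∀ {s c d cs ds} → T (leq s c) → T (leq c d) →
    All.All (λ y → T (leq d y)) cs → All.All (λ y → T (leq d y)) ds →
    #incDecFrom s (c ∷ cs) (d ∷ ds) ≡ #chains strictDec c d * #incDecFrom d cs ds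
  #incDecFrom-∷ {s} {c} {d} {cs} {ds} s≤c c≤d d≤cs d≤ds = begin
    ∑[ M ∈ lists (chainSize s top) ] (⟦ satFromTo M s top ⟧ * ⟦ incDecFrom s (c ∷ cs) (d ∷ ds) M ⟧)
      ≡⟨ ∑-cong (lists (chainSize s top)) (λ M →
           trans (cong (λ b → ⟦ satFromTo M s top ⟧ * ⟦ b ⟧) (incDecFrom-∷ s c d cs ds M))
                 (⟦∧⟧-regroup (satFromTo M s top) (memb c M) (weakInc (labs (seg s c M))) (Q M))) ⟩
    ∑[ M ∈ lists (chainSize s top) ] (⟦ satFromTo M s top ∧ memb c M ⟧ * (⟦ weakInc (labs (seg s c M)) ⟧ * ⟦ Q M ⟧))
      ≡⟨ ∑-chains-factor s≤c (top-max c) weakInc Q Q-local ⟩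
    #chains weakInc s c * ∑[ B ∈ lists (chainSize c top) ] (⟦ satFromTo B c top ⟧ * ⟦ Q B ⟧)
      ≡⟨ cong (_* ∑[ B ∈ lists (chainSize c top) ] (⟦ satFromTo B c top ⟧ * ⟦ Q B ⟧)) (#chains-weakInc≡1 s≤c) ⟩
    1 * ∑[ B ∈ lists (chainSize c top) ] (⟦ satFromTo B c top ⟧ * ⟦ Q B ⟧)
      ≡⟨ +-identityʳ _ ⟩
    ∑[ B ∈ lists (chainSize c top) ] (⟦ satFromTo B c top ⟧ * ⟦ Q B ⟧)
      ≡⟨ ∑-cong (lists (chainSize c top)) (λ B →
           ⟦∧⟧-regroup (satFromTo B c top) (memb d B) (strictDec (labs (seg c d B))) (incDecFrom d cs ds B)) ⟩
    ∑[ B ∈ lists (chainSize c top) ]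
      (⟦ satFromTo B c top ∧ memb d B ⟧ * (⟦ strictDec (labs (seg c d B)) ⟧ * ⟦ incDecFrom d cs ds B ⟧))
      ≡⟨ ∑-chains-factor c≤d (top-max d) strictDec (incDecFrom d cs ds) (λ g _ → incDecFrom-++ g _ (reflexive d) d≤cs d≤ds) ⟩
    #chains strictDec c d * #incDecFrom d cs ds
      ∎
    where
    open ≡-Reasoning
    Q : List El → Bool
    Q M = memb d M ∧ (strictDec (labs (seg c d M)) ∧ incDecFrom d cs ds M)
    c≤cs = All.map (leq-trans c≤d) d≤cs
    c≤ds = All.map (leq-trans c≤d) d≤ds
    Q-local : ∀ {A B} → SatChain s A c → SatChain c (c ∷ B) top → Q (A ++ B) ≡ Q (c ∷ B)
    Q-local g _ = cong₂ _∧_ (memb-++ g _ d c≤d)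
      (cong₂ _∧_ (cong (strictDec ∘ labs) (seg-++-above g _ c d (reflexive c))) (incDecFrom-++ g _ c≤d c≤cs c≤ds))

  ∏#decreasing : List El → List El → ℕ
  ∏#decreasing (c ∷ cs) (d ∷ ds) = #chains strictDec c d * ∏#decreasing cs ds
  ∏#decreasing _        _        = 1

  interlacing-above-first : ∀ c C D → T (isChain (c ∷ C)) → T (interlaces (c ∷ C) D) →
    All.All (λ y → T (leq c y)) C × All.All (λ y → T (leq c y)) D
  interlacing-above-first c []        (d ∷ [])  _  c≤d = All.[] , c≤d All.∷ All.[]
  interlacing-above-first c (c′ ∷ cs) (d ∷ ds) ch il with to (T-∧ {lt c c′}) ch | to (T-∧ {leq c d}) il
  ... | c<c′ , ch′ | c≤d , il′ with to (T-∧ {leq d c′}) il′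
  ... | _ , il″ with interlacing-above-first c′ cs ds ch′ il″
  ... | c′≤cs , c′≤ds = lt⇒leq c<c′ All.∷ All.map (leq-trans (lt⇒leq c<c′)) c′≤cs
                      , c≤d All.∷ All.map (leq-trans (lt⇒leq c<c′)) c′≤ds

  #incDecFrom≡∏ : ∀ {s} C D → All.All (λ y → T (leq s y)) C → T (isChain C) → T (interlaces C D) →
    #incDecFrom s C D ≡ ∏#decreasing C D
  #incDecFrom≡∏ {s} []             []       _              _  _  = #incDecFrom-[] s
  #incDecFrom≡∏     (c ∷ [])       (d ∷ []) (s≤c All.∷ _)  _  c≤d =
    trans (#incDecFrom-∷ s≤c c≤d All.[] All.[]) (cong (#chains strictDec c d *_) (#incDecFrom-[] d))
  #incDecFrom≡∏     (c ∷ c′ ∷ cs) (d ∷ ds) (s≤c All.∷ _) ch il with to (T-∧ {lt c c′}) ch | to (T-∧ {leq c d}) il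
  ... | _ , ch′ | c≤d , il′ with to (T-∧ {leq d c′}) il′
  ... | d≤c′ , il″ with interlacing-above-first c′ cs ds ch′ il″
  ... | c′≤cs , c′≤ds =
    trans (#incDecFrom-∷ s≤c c≤d (d≤c′ All.∷ All.map (leq-trans d≤c′) c′≤cs) (All.map (leq-trans d≤c′) c′≤ds))
          (cong (#chains strictDec c d *_) (#incDecFrom≡∏ (c′ ∷ cs) ds (d≤c′ All.∷ All.map (leq-trans d≤c′) c′≤cs) ch′ il″))

  length-∑ : ∀ {A : Set} (xs : List A) → length xs ≡ ∑ xs (λ _ → 1)
  length-∑ []       = refl
  length-∑ (x ∷ xs) = cong suc (length-∑ xs)

  #IncDec≡∏#decreasing : ∀ C D → T (isChain C) → T (interlaces C D) → #IncDec C D ≡ ∏#decreasing C D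
  #IncDec≡∏#decreasing C D ch il = begin
    length (filterᵇ (isIncDec C D) maxChains)
      ≡⟨ length-∑ (filterᵇ (isIncDec C D) maxChains) ⟩
    ∑ (filterᵇ (isIncDec C D) maxChains) (λ _ → 1)
      ≡⟨ ∑-filter (isIncDec C D) maxChains _ ⟩
    ∑[ M ∈ maxChains ] (⟦ isIncDec C D M ⟧ * 1)
      ≡⟨ ∑-filter (λ M → satFromTo M bot top) (lists (suc (rank top))) _ ⟩
    ∑[ M ∈ lists (suc (rank top)) ] (⟦ satFromTo M bot top ⟧ * (⟦ isIncDec C D M ⟧ * 1))
      ≡⟨ ∑-cong (lists (suc (rank top))) (λ M → cong (⟦ satFromTo M bot top ⟧ *_) (*-identityʳ _)) ⟩
    ∑[ M ∈ lists (suc (rank top)) ] (⟦ satFromTo M bot top ⟧ * ⟦ incDecFrom bot C D M ⟧)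
      ≡⟨ cong (λ n → ∑[ M ∈ lists (suc n) ] (⟦ satFromTo M bot top ⟧ * ⟦ incDecFrom bot C D M ⟧))
              (cong (rank top ∸_) (sym rank-bot)) ⟩
    #incDecFrom bot C D
      ≡⟨ #incDecFrom≡∏ C D (All.tabulate (λ {c} _ → bot-min c)) ch il ⟩
    ∏#decreasing C D
      ∎
    where open ≡-Reasoning

  #chains-strictDec-through : ∀ {a z x} → T (leq a z) → T (leq z x) →
    #chains strictDec a z ≡
    ∑[ M ∈ lists (chainSize a x) ]
      (⟦ satFromTo M a x ∧ memb z M ⟧ * (⟦ strictDec (labs (seg a z M)) ⟧ * ⟦ weakInc (labs (dropTo z M)) ⟧))
  #chains-strictDec-through {a} {z} {x} a≤z z≤x = sym (begin
    ∑[ M ∈ lists (chainSize a x) ]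
      (⟦ satFromTo M a x ∧ memb z M ⟧ * (⟦ strictDec (labs (seg a z M)) ⟧ * ⟦ weakInc (labs (dropTo z M)) ⟧))
      ≡⟨ ∑-chains-factor a≤z z≤x strictDec (weakInc ∘ labs ∘ dropTo z)
           (λ g _ → cong (weakInc ∘ labs) (dropTo-++ g _ z (reflexive z))) ⟩
    #chains strictDec a z * ∑[ B ∈ lists (chainSize z x) ] (⟦ satFromTo B z x ⟧ * ⟦ weakInc (labs (dropTo z B)) ⟧)
      ≡⟨ cong (#chains strictDec a z *_) (trans (∑-cong (lists (chainSize z x)) λ B → ⟦⟧-*-cong (satFromTo B z x) λ sat →
           cong (⟦_⟧ ∘ weakInc ∘ labs) (from-head (satFromTo⇒SatChain {z} {B} {x} sat)))
         (#chains-weakInc≡1 z≤x)) ⟩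
    #chains strictDec a z * 1
      ≡⟨ *-identityʳ _ ⟩
    #chains strictDec a z
      ∎)
    where
    open ≡-Reasoning
    from-head : ∀ {B} → SatChain z B x → dropTo z B ≡ B
    from-head {B} g = trans (cong (dropTo z) (sym (chain-∷ g))) (trans (dropTo-head z (drop 1 B)) (chain-∷ g))

  #chains-refl : ∀ F a → #chains F a a ≡ ⟦ F [] ⟧
  #chains-refl F a = begin
    ∑[ A ∈ lists (chainSize a a) ] (⟦ satFromTo A a a ⟧ * ⟦ F (labs A) ⟧)
      ≡⟨ ∑-lists-δ (a ∷ []) (cong suc (sym (n∸n≡0 (rank a)))) _ only-[a] ⟩
    ⟦ satFromTo (a ∷ []) a a ⟧ * ⟦ F [] ⟧
      ≡⟨ cong (_* ⟦ F [] ⟧) (cong ⟦_⟧ (to T-≡ (SatChain⇒satFromTo {a} {a ∷ []} {a} done))) ⟩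
    1 * ⟦ F [] ⟧
      ≡⟨ *-identityˡ _ ⟩
    ⟦ F [] ⟧
      ∎
    where
    open ≡-Reasoning
    only-[a] : ∀ A → A ≢ a ∷ [] → ⟦ satFromTo A a a ⟧ * ⟦ F (labs A) ⟧ ≡ 0
    only-[a] A A≢[a] = ⟦false⟧-* (satFromTo A a a) _ (A≢[a] ∘ chain-trivial ∘ satFromTo⇒SatChain)

module Moebius (P : FinPoset) (G : IsGraded P) (lab : PosetDefs.El P → PosetDefs.El P → ℕ) (RL : GradedDefs.IsRLabeling P G lab) where

  open import Data.Bool using (Bool; true; false; T; _∧_; not)
  open import Data.Bool.Properties using (T-∧; T-≡; T?; ∧-identityʳ)
  open import Data.Fin using (_≟_)
  open import Data.Integer using (ℤ; +_; -_; _+_; _*_; _^_; 0ℤ; 1ℤ; -1ℤ; ∣_∣)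
  import Data.Integer.Properties as ZP
  open import Data.List using (List; []; _∷_; map; filterᵇ; length)
  open import Data.List.Relation.Unary.All as All using (All; []; _∷_)
  open import Data.List.Relation.Unary.Unique.Propositional using (Unique; []; _∷_)
  import Data.Nat as ℕ
  open import Data.Nat using (zero; suc; _∸_)
  import Data.Nat.Properties as NP
  open import Data.Product using (_×_; _,_; proj₁; proj₂; map₁)
  open import Function using (_∘_)
  open import Function.Bundles using (Equivalence)
  open import Relation.Binary.PropositionalEquality
  open import Relation.Nullary using (Dec; yes; no; contradiction)

  open import Algebra.Properties.AbelianGroup ZP.+-0-abelianGroup using (inverseʳ-unique)
  open import Algebra.Properties.CommutativeSemigroup ZP.*-commutativeSemigroup using (x∙yz≈y∙xz)
  open GradedDefs P G
  open Labels lab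
  open Arithmetic
  open Chains P
  open Segments P G lab
  open Counting P G lab RL
  open GradedChains P G saturated
  open ListSum ZP.+-*-commutativeSemiring
  module ℕ∑ = ListSum NP.+-*-commutativeSemiring
  open Equivalence using (to; from)

  splits : {A : Set} → List A → List (List A × List A)
  splits []       = ([] , []) ∷ []
  splits (x ∷ xs) = ([] , x ∷ xs) ∷ map (map₁ (x ∷_)) (splits xs)

  alternating : (List ℕ → Bool) → List ℕ → ℤ
  alternating F ls = ∑[ p ∈ splits ls ] (-1ℤ ^ length (proj₁ p) * (⟦ F (proj₁ p) ⟧ * ⟦ weakInc (proj₂ p) ⟧))

  ∑-neg : {A : Set} (xs : List A) (f : A → ℤ) → ∑[ x ∈ xs ] (- f x) ≡ - ∑ xs f
  ∑-neg xs f = begin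
    ∑[ x ∈ xs ] (- f x)    ≡⟨ ∑-cong xs (λ x → ZP.-1*i≡-i (f x)) ⟨
    ∑[ x ∈ xs ] (-1ℤ * f x) ≡⟨ *-distribˡ-∑ -1ℤ xs f ⟨
    -1ℤ * ∑ xs f           ≡⟨ ZP.-1*i≡-i _ ⟩
    - ∑ xs f               ∎
    where open ≡-Reasoning

  alternating-∷ : ∀ F l ls → alternating F (l ∷ ls) ≡ ⟦ F [] ⟧ * ⟦ weakInc (l ∷ ls) ⟧ + - alternating (F ∘ (l ∷_)) ls
  alternating-∷ F l ls = cong₂ _+_ (ZP.*-identityˡ (⟦ F [] ⟧ * ⟦ weakInc (l ∷ ls) ⟧)) (begin
    ∑ (map (map₁ (l ∷_)) (splits ls)) term
      ≡⟨ ∑-map (map₁ (l ∷_)) (splits ls) term ⟩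
    ∑[ p ∈ splits ls ] (-1ℤ * (-1ℤ ^ length (proj₁ p)) * (⟦ F (l ∷ proj₁ p) ⟧ * ⟦ weakInc (proj₂ p) ⟧))
      ≡⟨ ∑-cong (splits ls) (λ p → trans (ZP.*-assoc -1ℤ (-1ℤ ^ length (proj₁ p)) _) (ZP.-1*i≡-i _)) ⟩
    ∑[ p ∈ splits ls ] (- (-1ℤ ^ length (proj₁ p) * (⟦ F (l ∷ proj₁ p) ⟧ * ⟦ weakInc (proj₂ p) ⟧)))
      ≡⟨ ∑-neg (splits ls) _ ⟩
    - alternating (F ∘ (l ∷_)) ls
      ∎)
    where
    open ≡-Reasoning
    term : List ℕ × List ℕ → ℤ
    term p = -1ℤ ^ length (proj₁ p) * (⟦ F (proj₁ p) ⟧ * ⟦ weakInc (proj₂ p) ⟧)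

  alternating-∧ : ∀ b F ls → alternating (λ u → b ∧ F u) ls ≡ ⟦ b ⟧ * alternating F ls
  alternating-∧ b F ls = begin
    ∑[ p ∈ splits ls ] (-1ℤ ^ length (proj₁ p) * (⟦ b ∧ F (proj₁ p) ⟧ * ⟦ weakInc (proj₂ p) ⟧))
      ≡⟨ ∑-cong (splits ls) (λ p → pull-out (-1ℤ ^ length (proj₁ p)) (F (proj₁ p)) ⟦ weakInc (proj₂ p) ⟧) ⟩
    ∑[ p ∈ splits ls ] (⟦ b ⟧ * (-1ℤ ^ length (proj₁ p) * (⟦ F (proj₁ p) ⟧ * ⟦ weakInc (proj₂ p) ⟧)))
      ≡⟨ *-distribˡ-∑ ⟦ b ⟧ (splits ls) _ ⟨
    ⟦ b ⟧ * alternating F ls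
      ∎
    where
    open ≡-Reasoning
    pull-out : ∀ s f w → s * (⟦ b ∧ f ⟧ * w) ≡ ⟦ b ⟧ * (s * (⟦ f ⟧ * w))
    pull-out s f w = begin
      s * (⟦ b ∧ f ⟧ * w)        ≡⟨ cong (λ t → s * (t * w)) (⟦∧⟧ b f) ⟩
      s * (⟦ b ⟧ * ⟦ f ⟧ * w)    ≡⟨ cong (s *_) (ZP.*-assoc ⟦ b ⟧ ⟦ f ⟧ w) ⟩
      s * (⟦ b ⟧ * (⟦ f ⟧ * w))  ≡⟨ x∙yz≈y∙xz s ⟦ b ⟧ (⟦ f ⟧ * w) ⟩
      ⟦ b ⟧ * (s * (⟦ f ⟧ * w))  ∎

  alternating-strictDec-∷ : ∀ l ls → alternating (strictDec ∘ (l ∷_)) ls ≡ ⟦ weakInc (l ∷ ls) ⟧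
  alternating-strictDec-∷ l []       = refl
  alternating-strictDec-∷ l (m ∷ ls) = begin
    alternating (strictDec ∘ (l ∷_)) (m ∷ ls)
      ≡⟨ alternating-∷ (strictDec ∘ (l ∷_)) m ls ⟩
    1ℤ * ⟦ weakInc (m ∷ ls) ⟧ + - alternating (λ u → (m ℕ.<ᵇ l) ∧ strictDec (m ∷ u)) ls
      ≡⟨ cong (λ t → 1ℤ * ⟦ weakInc (m ∷ ls) ⟧ + - t)
           (trans (alternating-∧ (m ℕ.<ᵇ l) (strictDec ∘ (m ∷_)) ls) (cong (⟦ m ℕ.<ᵇ l ⟧ *_) (alternating-strictDec-∷ m ls))) ⟩
    1ℤ * ⟦ weakInc (m ∷ ls) ⟧ + - (⟦ m ℕ.<ᵇ l ⟧ * ⟦ weakInc (m ∷ ls) ⟧)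
      ≡⟨ complement (m ℕ.<ᵇ l) (weakInc (m ∷ ls)) ⟩
    ⟦ not (m ℕ.<ᵇ l) ∧ weakInc (m ∷ ls) ⟧
      ≡⟨ cong (λ b → ⟦ b ∧ weakInc (m ∷ ls) ⟧) (≤ᵇ≡not-<ᵇ l m) ⟨
    ⟦ weakInc (l ∷ m ∷ ls) ⟧
      ∎
    where
    open ≡-Reasoning
    complement : ∀ b w → 1ℤ * ⟦ w ⟧ + - (⟦ b ⟧ * ⟦ w ⟧) ≡ ⟦ not b ∧ w ⟧
    complement true  true  = refl
    complement true  false = refl
    complement false true  = refl
    complement false false = refl

  alternating-strictDec : ∀ l ls → alternating strictDec (l ∷ ls) ≡ 0ℤ
  alternating-strictDec l ls = begin
    alternating strictDec (l ∷ ls)                                  ≡⟨ alternating-∷ strictDec l ls ⟩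
    1ℤ * ⟦ weakInc (l ∷ ls) ⟧ + - alternating (strictDec ∘ (l ∷_)) ls ≡⟨ cong₂ (λ s t → s + - t)
                                                                         (ZP.*-identityˡ ⟦ weakInc (l ∷ ls) ⟧) (alternating-strictDec-∷ l ls) ⟩
    ⟦ weakInc (l ∷ ls) ⟧ + - ⟦ weakInc (l ∷ ls) ⟧                    ≡⟨ ZP.+-inverseʳ ⟦ weakInc (l ∷ ls) ⟧ ⟩
    0ℤ                                                              ∎
    where open ≡-Reasoning

  chainTerm : (List ℕ → Bool) → El → List El → El → ℤ
  chainTerm F a M z = -1ℤ ^ (rank z ∸ rank a) * (⟦ F (labs (seg a z M)) ⟧ * ⟦ weakInc (labs (dropTo z M)) ⟧)

  chainTerm-head : ∀ F a L → chainTerm F a (a ∷ L) a ≡ ⟦ F [] ⟧ * ⟦ weakInc (labs (a ∷ L)) ⟧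
  chainTerm-head F a L rewrite NP.n∸n≡0 (rank a) | seg-head a L | dropTo-head a L = ZP.*-identityˡ _

  ∑-chain-alternating : ∀ F {a M x} → SatChain a M x → ∑ M (chainTerm F a M) ≡ alternating F (labs M)
  ∑-chain-alternating F {a} done = cong (_+ 0ℤ) (trans (chainTerm-head F a []) (sym (ZP.*-identityˡ _)))
  ∑-chain-alternating F {a} (step {y = y} {r = r} a⋖y g) = begin
    chainTerm F a M a + ∑ (y ∷ r) (chainTerm F a M)
      ≡⟨ cong₂ _+_ (chainTerm-head F a (y ∷ r)) (∑-cong-All (All.map (shift ∘ proj₁) (chain-within g))) ⟩
    ⟦ F [] ⟧ * ⟦ weakInc (labs M) ⟧ + ∑[ z ∈ y ∷ r ] (- chainTerm F′ y (y ∷ r) z)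
      ≡⟨ cong (λ t → ⟦ F [] ⟧ * ⟦ weakInc (labs M) ⟧ + t) (trans (∑-neg (y ∷ r) (chainTerm F′ y (y ∷ r))) (cong -_ (∑-chain-alternating F′ g))) ⟩
    ⟦ F [] ⟧ * ⟦ weakInc (labs M) ⟧ + - alternating F′ (labs (y ∷ r))
      ≡⟨ alternating-∷ F (lab a y) (labs (y ∷ r)) ⟨
    alternating F (labs M)
      ∎
    where
    open ≡-Reasoning
    M = a ∷ y ∷ r
    F′ = F ∘ (lab a y ∷_)
    shift : ∀ {z} → T (leq y z) → chainTerm F a M z ≡ - chainTerm F′ y (y ∷ r) z
    shift {z} y≤z = begin
      -1ℤ ^ (rank z ∸ rank a) * (⟦ F (labs (seg a z M)) ⟧ * ⟦ weakInc (labs (dropTo z M)) ⟧)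
        ≡⟨ cong₂ (λ S D → -1ℤ ^ (rank z ∸ rank a) * (⟦ F (labs S) ⟧ * ⟦ weakInc (labs D) ⟧)) (seg-∷ (y ∷ r) z≢a) (dropTo-∷ (y ∷ r) z≢a) ⟩
      -1ℤ ^ (rank z ∸ rank a) * (⟦ F (labs (a ∷ takeTo z (y ∷ r))) ⟧ * ⟦ weakInc (labs (dropTo z (y ∷ r))) ⟧)
        ≡⟨ cong₂ (λ k L → -1ℤ ^ k * (⟦ F L ⟧ * ⟦ weakInc (labs (dropTo z (y ∷ r))) ⟧)) (rank-∸-cov a⋖y y≤z) (labs-∷-takeTo a y z r) ⟩
      -1ℤ * -1ℤ ^ (rank z ∸ rank y) * (⟦ F′ (labs (seg y z (y ∷ r))) ⟧ * ⟦ weakInc (labs (dropTo z (y ∷ r))) ⟧)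
        ≡⟨ ZP.*-assoc -1ℤ (-1ℤ ^ (rank z ∸ rank y)) _ ⟩
      -1ℤ * chainTerm F′ y (y ∷ r) z
        ≡⟨ ZP.-1*i≡-i _ ⟩
      - chainTerm F′ y (y ∷ r) z
        ∎
      where
      z≢a : z ≢ a
      z≢a refl = lt⇒≢ (cov⇒lt a⋖y) (antisym _ _ (lt⇒leq (cov⇒lt a⋖y)) y≤z)

  ∑-chain-strictDec : ∀ {a M x} → T (lt a x) → SatChain a M x → ∑ M (chainTerm strictDec a M) ≡ 0ℤ
  ∑-chain-strictDec a<x done                 = contradiction refl (lt⇒≢ a<x)
  ∑-chain-strictDec a<x g@(step {a} {y} {r} _ _) = trans (∑-chain-alternating strictDec g) (alternating-strictDec (lab a y) (labs (y ∷ r)))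

  ∑-memb : ∀ {M} → Unique M → (g : El → ℤ) → ∑[ z ∈ elems ] (⟦ memb z M ⟧ * g z) ≡ ∑ M g
  ∑-memb []                  g = ∑-zero elems (λ z → ZP.*-zeroˡ (g z))
  ∑-memb {m ∷ M} (m∉M ∷ uM) g = begin
    ∑[ z ∈ elems ] (⟦ memb z (m ∷ M) ⟧ * g z)
      ≡⟨ ∑-cong elems split ⟩
    ∑[ z ∈ elems ] (⟦ eqb z m ⟧ * g z + ⟦ memb z M ⟧ * g z)
      ≡⟨ ∑-distrib-+ elems _ _ ⟩
    ∑[ z ∈ elems ] (⟦ eqb z m ⟧ * g z) + ∑[ z ∈ elems ] (⟦ memb z M ⟧ * g z)
      ≡⟨ cong₂ _+_ (∑-allFin-δ N m _ (λ z z≢m → cong (_* g z) (cong ⟦_⟧ (eqb-≢ z≢m)))) (∑-memb uM g) ⟩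
    ⟦ eqb m m ⟧ * g m + ∑ M g
      ≡⟨ cong (λ b → ⟦ b ⟧ * g m + ∑ M g) (eqb-refl m) ⟩
    1ℤ * g m + ∑ M g
      ≡⟨ cong (_+ ∑ M g) (ZP.*-identityˡ (g m)) ⟩
    g m + ∑ M g
      ∎
    where
    open ≡-Reasoning
    split : ∀ z → ⟦ memb z (m ∷ M) ⟧ * g z ≡ ⟦ eqb z m ⟧ * g z + ⟦ memb z M ⟧ * g z
    split z = by-cases (z ≟ m)
      where
      by-cases : Dec (z ≡ m) → ⟦ memb z (m ∷ M) ⟧ * g z ≡ ⟦ eqb z m ⟧ * g z + ⟦ memb z M ⟧ * g z
      by-cases (yes refl) rewrite eqb-refl m =
        sym (trans (cong (_+_ (1ℤ * g m)) (⟦false⟧-* (memb m M) (g m) (λ m∈M → All.lookup m∉M (memb⇒∈ m∈M) refl))) (ZP.+-identityʳ _))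
      by-cases (no z≢m) rewrite eqb-≢ z≢m = sym (ZP.+-identityˡ _)

  +-∑ : {A : Set} (xs : List A) (f : A → ℕ) → + ℕ∑.∑ xs f ≡ ∑[ x ∈ xs ] (+ f x)
  +-∑ []       f = refl
  +-∑ (x ∷ xs) f = trans (ZP.pos-+ (f x) _) (cong (_+_ (+ f x)) (+-∑ xs f))

  +-⟦⟧ : ∀ b → + ℕ∑.⟦ b ⟧ ≡ ⟦ b ⟧
  +-⟦⟧ true  = refl
  +-⟦⟧ false = refl

  sumℤ-map : {A : Set} (f : A → ℤ) (xs : List A) → sumℤ (map f xs) ≡ ∑ xs f
  sumℤ-map f []       = refl
  sumℤ-map f (x ∷ xs) = cong (_+_ (f x)) (sumℤ-map f xs)

  signed#decreasing : El → El → ℤ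
  signed#decreasing a z = -1ℤ ^ (rank z ∸ rank a) * + #chains strictDec a z

  chain-member-within : ∀ {a x z} M → T (satFromTo M a x ∧ memb z M) → T (leq a z ∧ leq z x)
  chain-member-within {a} {x} M sat∧z∈ with to (T-∧ {satFromTo M a x}) sat∧z∈
  ... | sat , z∈ = from T-∧ (All.lookup (chain-within (satFromTo⇒SatChain {a} {M} {x} sat)) (memb⇒∈ z∈))

  signed#decreasing-through : ∀ a x z →
    ⟦ leq a z ∧ leq z x ⟧ * signed#decreasing a z ≡
    ∑[ M ∈ lists (chainSize a x) ] (⟦ satFromTo M a x ∧ memb z M ⟧ * chainTerm strictDec a M z)
  signed#decreasing-through a x z with T? (leq a z ∧ leq z x)
  ... | no ¬within = trans (⟦false⟧-* _ _ ¬within)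
                           (sym (∑-zero (lists (chainSize a x)) (λ M → ⟦false⟧-* _ _ (¬within ∘ chain-member-within M))))
  ... | yes within with to (T-∧ {leq a z}) within
  ... | a≤z , z≤x = begin
    ⟦ leq a z ∧ leq z x ⟧ * signed#decreasing a z
      ≡⟨ cong (λ b → ⟦ b ⟧ * signed#decreasing a z) (to T-≡ within) ⟩
    1ℤ * (s * + #chains strictDec a z)
      ≡⟨ ZP.*-identityˡ _ ⟩
    s * + #chains strictDec a z
      ≡⟨ cong (λ n → s * + n) (#chains-strictDec-through a≤z z≤x) ⟩
    s * + ℕ∑.∑ Ms (λ M → ℕ∑.⟦ sat∧z∈ M ⟧ ℕ.* (ℕ∑.⟦ dec M ⟧ ℕ.* ℕ∑.⟦ inc M ⟧))
      ≡⟨ cong (s *_) (+-∑ Ms _) ⟩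
    s * ∑[ M ∈ Ms ] (+ (ℕ∑.⟦ sat∧z∈ M ⟧ ℕ.* (ℕ∑.⟦ dec M ⟧ ℕ.* ℕ∑.⟦ inc M ⟧)))
      ≡⟨ *-distribˡ-∑ s Ms _ ⟩
    ∑[ M ∈ Ms ] (s * + (ℕ∑.⟦ sat∧z∈ M ⟧ ℕ.* (ℕ∑.⟦ dec M ⟧ ℕ.* ℕ∑.⟦ inc M ⟧)))
      ≡⟨ ∑-cong Ms (λ M → trans (cong (s *_) (cast M)) (x∙yz≈y∙xz s ⟦ sat∧z∈ M ⟧ _)) ⟩
    ∑[ M ∈ Ms ] (⟦ sat∧z∈ M ⟧ * chainTerm strictDec a M z)
      ∎
    where
    open ≡-Reasoning
    s = -1ℤ ^ (rank z ∸ rank a)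
    Ms = lists (chainSize a x)
    sat∧z∈ dec inc : List El → Bool
    sat∧z∈ M = satFromTo M a x ∧ memb z M
    dec M = strictDec (labs (seg a z M))
    inc M = weakInc (labs (dropTo z M))
    cast : ∀ M → + (ℕ∑.⟦ sat∧z∈ M ⟧ ℕ.* (ℕ∑.⟦ dec M ⟧ ℕ.* ℕ∑.⟦ inc M ⟧)) ≡ ⟦ sat∧z∈ M ⟧ * (⟦ dec M ⟧ * ⟦ inc M ⟧)
    cast M = trans (ZP.pos-* ℕ∑.⟦ sat∧z∈ M ⟧ _) (cong₂ _*_ (+-⟦⟧ (sat∧z∈ M))
                   (trans (ZP.pos-* ℕ∑.⟦ dec M ⟧ _) (cong₂ _*_ (+-⟦⟧ (dec M)) (+-⟦⟧ (inc M)))))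

  ∑-signed#decreasing : ∀ {a x} → T (lt a x) → ∑[ z ∈ elems ] (⟦ leq a z ∧ leq z x ⟧ * signed#decreasing a z) ≡ 0ℤ
  ∑-signed#decreasing {a} {x} a<x = begin
    ∑[ z ∈ elems ] (⟦ leq a z ∧ leq z x ⟧ * signed#decreasing a z)
      ≡⟨ ∑-cong elems (signed#decreasing-through a x) ⟩
    ∑[ z ∈ elems ] ∑[ M ∈ Ms ] (⟦ satFromTo M a x ∧ memb z M ⟧ * chainTerm strictDec a M z)
      ≡⟨ ∑-comm elems Ms _ ⟩
    ∑[ M ∈ Ms ] ∑[ z ∈ elems ] (⟦ satFromTo M a x ∧ memb z M ⟧ * chainTerm strictDec a M z)
      ≡⟨ ∑-zero Ms along-chain ⟩
    0ℤ
      ∎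
    where
    open ≡-Reasoning
    Ms = lists (chainSize a x)
    along-chain : ∀ M → ∑[ z ∈ elems ] (⟦ satFromTo M a x ∧ memb z M ⟧ * chainTerm strictDec a M z) ≡ 0ℤ
    along-chain M = begin
      ∑[ z ∈ elems ] (⟦ satFromTo M a x ∧ memb z M ⟧ * chainTerm strictDec a M z)
        ≡⟨ ∑-cong elems (λ z → trans (cong (_* chainTerm strictDec a M z) (⟦∧⟧ (satFromTo M a x) (memb z M)))
                                     (ZP.*-assoc ⟦ satFromTo M a x ⟧ ⟦ memb z M ⟧ _)) ⟩
      ∑[ z ∈ elems ] (⟦ satFromTo M a x ⟧ * (⟦ memb z M ⟧ * chainTerm strictDec a M z))
        ≡⟨ *-distribˡ-∑ ⟦ satFromTo M a x ⟧ elems _ ⟨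
      ⟦ satFromTo M a x ⟧ * ∑[ z ∈ elems ] (⟦ memb z M ⟧ * chainTerm strictDec a M z)
        ≡⟨ ⟦⟧-*-cong (satFromTo M a x) (λ sat → let g = satFromTo⇒SatChain {a} {M} {x} sat in
             trans (∑-memb (chain-unique g) _) (∑-chain-strictDec a<x g)) ⟩
      ⟦ satFromTo M a x ⟧ * 0ℤ
        ≡⟨ ZP.*-zeroʳ ⟦ satFromTo M a x ⟧ ⟩
      0ℤ
        ∎

  ⟦interval⟧-split : ∀ {a x} → T (leq a x) → ∀ z → ⟦ leq a z ∧ leq z x ⟧ ≡ ⟦ leq a z ∧ lt z x ⟧ + ⟦ eqb z x ⟧
  ⟦interval⟧-split {a} {x} a≤x z = by-cases (z ≟ x)
    where
    by-cases : Dec (z ≡ x) → ⟦ leq a z ∧ leq z x ⟧ ≡ ⟦ leq a z ∧ lt z x ⟧ + ⟦ eqb z x ⟧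
    by-cases (yes refl) rewrite eqb-refl x | to T-≡ a≤x | to T-≡ (reflexive x) = refl
    by-cases (no z≢x)   rewrite eqb-≢ z≢x | ∧-identityʳ (leq z x) = sym (ZP.+-identityʳ _)

  signed#decreasing-refl : ∀ a → signed#decreasing a a ≡ 1ℤ
  signed#decreasing-refl a = cong₂ (λ k n → -1ℤ ^ k * + n) (NP.n∸n≡0 (rank a)) (#chains-refl strictDec a)

  signed#decreasing-recursion : ∀ {a x} → T (lt a x) →
    signed#decreasing a x ≡ - ∑[ z ∈ elems ] (⟦ leq a z ∧ lt z x ⟧ * signed#decreasing a z)
  signed#decreasing-recursion {a} {x} a<x = inverseʳ-unique _ _ (begin
    ∑[ z ∈ elems ] (⟦ leq a z ∧ lt z x ⟧ * ν z) + ν x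
      ≡⟨ cong (_+_ (∑[ z ∈ elems ] (⟦ leq a z ∧ lt z x ⟧ * ν z))) at-x ⟨
    ∑[ z ∈ elems ] (⟦ leq a z ∧ lt z x ⟧ * ν z) + ∑[ z ∈ elems ] (⟦ eqb z x ⟧ * ν z)
      ≡⟨ ∑-distrib-+ elems _ _ ⟨
    ∑[ z ∈ elems ] (⟦ leq a z ∧ lt z x ⟧ * ν z + ⟦ eqb z x ⟧ * ν z)
      ≡⟨ ∑-cong elems (λ z → trans (sym (ZP.*-distribʳ-+ (ν z) ⟦ leq a z ∧ lt z x ⟧ _))
                                   (cong (_* ν z) (sym (⟦interval⟧-split (lt⇒leq a<x) z)))) ⟩
    ∑[ z ∈ elems ] (⟦ leq a z ∧ leq z x ⟧ * ν z)
      ≡⟨ ∑-signed#decreasing a<x ⟩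
    0ℤ
      ∎)
    where
    open ≡-Reasoning
    ν = signed#decreasing a
    at-x : ∑[ z ∈ elems ] (⟦ eqb z x ⟧ * ν z) ≡ ν x
    at-x = trans (∑-allFin-δ N x _ (λ z z≢x → trans (cong (λ b → ⟦ b ⟧ * ν z) (eqb-≢ z≢x)) (ZP.*-zeroˡ (ν z))))
                 (trans (cong (λ b → ⟦ b ⟧ * ν x) (eqb-refl x)) (ZP.*-identityˡ (ν x)))

  muF≡signed#decreasing : ∀ f {a x} → T (leq a x) → rank x ∸ rank a ℕ.< f → muF f a x ≡ signed#decreasing a x
  muF≡signed#decreasing (suc f) {a} {x} a≤x k<f = by-cases (a ≟ x)
    where
    q : El → Bool
    q z = leq a z ∧ lt z x
    below : ∀ z → ⟦ q z ⟧ * muF f a z ≡ ⟦ q z ⟧ * signed#decreasing a z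
    below z = ⟦⟧-*-cong (q z) λ qz → let a≤z , z<x = to (T-∧ {leq a z}) qz in
      muF≡signed#decreasing f a≤z (NP.<-≤-trans (NP.∸-monoˡ-< (rank-strict z<x) (rank-mono a≤z)) (NP.≤-pred k<f))
    by-cases : Dec (a ≡ x) → muF (suc f) a x ≡ signed#decreasing a x
    by-cases (yes refl) rewrite eqb-refl a = sym (signed#decreasing-refl a)
    by-cases (no a≢x) rewrite eqb-≢ a≢x | to T-≡ a≤x = begin
      - sumℤ (map (muF f a) (filterᵇ q elems))
        ≡⟨ cong -_ (trans (sumℤ-map (muF f a) (filterᵇ q elems)) (∑-filter q elems (muF f a))) ⟩
      - ∑[ z ∈ elems ] (⟦ q z ⟧ * muF f a z)
        ≡⟨ cong -_ (∑-cong elems below) ⟩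
      - ∑[ z ∈ elems ] (⟦ q z ⟧ * signed#decreasing a z)
        ≡⟨ signed#decreasing-recursion (leq∧≢⇒lt a≤x a≢x) ⟨
      signed#decreasing a x
        ∎
      where open ≡-Reasoning

  ∣-1^n∣≡1 : ∀ n → ∣ -1ℤ ^ n ∣ ≡ 1
  ∣-1^n∣≡1 zero    = refl
  ∣-1^n∣≡1 (suc n) = trans (ZP.abs-* -1ℤ (-1ℤ ^ n)) (trans (NP.*-identityˡ _) (∣-1^n∣≡1 n))

  ∣μ∣≡#decreasing : ∀ {a x} → T (leq a x) → ∣ μ a x ∣ ≡ #chains strictDec a x
  ∣μ∣≡#decreasing {a} {x} a≤x = begin
    ∣ μ a x ∣                                            ≡⟨ cong ∣_∣ (muF≡signed#decreasing N a≤x (NP.≤-<-trans (NP.m∸n≤m (rank x) (rank a)) (rank<N x))) ⟩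
    ∣ -1ℤ ^ (rank x ∸ rank a) * + #chains strictDec a x ∣ ≡⟨ ZP.abs-* (-1ℤ ^ (rank x ∸ rank a)) _ ⟩
    ∣ -1ℤ ^ (rank x ∸ rank a) ∣ ℕ.* #chains strictDec a x ≡⟨ cong (ℕ._* #chains strictDec a x) (∣-1^n∣≡1 (rank x ∸ rank a)) ⟩
    1 ℕ.* #chains strictDec a x                          ≡⟨ NP.*-identityˡ _ ⟩
    #chains strictDec a x                                ∎
    where open ≡-Reasoning

module Poincare (P : FinPoset) (G : IsGraded P) (lab : PosetDefs.El P → PosetDefs.El P → ℕ) (RL : GradedDefs.IsRLabeling P G lab) where

  open import Data.Bool using (Bool; T; _∧_; if_then_else_)
  open import Data.Bool.Properties using (T-∧; T-≡; ∧-assoc; ∧-identityʳ; ∧-zeroʳ)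
  open import Data.Integer using (∣_∣)
  open import Data.List using (List; []; _∷_; map; length; filterᵇ; upTo)
  open import Data.List.Properties using (map-upTo)
  open import Data.Nat using (zero; suc; _+_; _*_; _∸_; _≤_; z≤n; _≡ᵇ_; _≤ᵇ_)
  open import Data.Nat.ListAction using (sum)
  open import Data.Nat.Properties
  open import Data.Nat.Tactic.RingSolver using (solve-∀)
  open import Data.Product using (_,_; proj₁; proj₂)
  open import Function using (_∘_)
  open import Function.Bundles using (Equivalence)
  open import Relation.Binary.PropositionalEquality

  open GradedDefs P G
  open Labels lab
  open Arithmetic
  open Chains P
  open Counting P G lab RL
  open GradedChains P G saturated
  open Moebius P G lab RL using (∣μ∣≡#decreasing)
  open ListSum +-*-commutativeSemiring
  open Equivalence using (to)

  sum-map : {A : Set} (f : A → ℕ) (xs : List A) → sum (map f xs) ≡ ∑ xs f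
  sum-map f []       = refl
  sum-map f (x ∷ xs) = cong (f x +_) (sum-map f xs)

  ∑-upTo-suc : ∀ ℓ (h : ℕ → ℕ) → ∑ (upTo (suc ℓ)) h ≡ h 0 + ∑[ i ∈ upTo ℓ ] h (suc i)
  ∑-upTo-suc ℓ h = cong (h 0 +_) (trans (cong (λ is → ∑ is h) (sym (map-upTo suc ℓ))) (∑-map suc (upTo ℓ) h))

  ∑-upTo-δ : ∀ ℓ e (g : ℕ → ℕ) → ∑[ i ∈ upTo (suc ℓ) ] (⟦ e ≡ᵇ i ⟧ * g i) ≡ ⟦ e ≤ᵇ ℓ ⟧ * g e
  ∑-upTo-δ ℓ       zero    g = trans (∑-upTo-suc ℓ (λ i → ⟦ 0 ≡ᵇ i ⟧ * g i)) (trans (cong (1 * g 0 +_) (∑-zero (upTo ℓ) λ _ → refl)) (+-identityʳ _))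
  ∑-upTo-δ zero    (suc e) g = refl
  ∑-upTo-δ (suc ℓ) (suc e) g =
    trans (∑-upTo-suc (suc ℓ) (λ i → ⟦ suc e ≡ᵇ i ⟧ * g i)) (trans (∑-upTo-δ ℓ e (g ∘ suc)) (cong (λ b → ⟦ b ⟧ * g (suc e)) (≤ᵇ≡<ᵇ-suc e ℓ)))

  interlacingSum : List El → ℕ → ℕ
  interlacingSum C ℓ = ∑[ D ∈ lists (length C) ] (⟦ interlaces C D ⟧ * (⟦ irank C D ≡ᵇ ℓ ⟧ * ∏#decreasing C D))

  rhsCoeff≡interlacingSum : ∀ C ℓ → T (isChain C) → rhsCoeff C ℓ ≡ interlacingSum C ℓ
  rhsCoeff≡interlacingSum C ℓ ch = begin
    sum (map (λ D → if irank C D ≡ᵇ ℓ then #IncDec C D else 0) (IL C))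
      ≡⟨ sum-map _ (IL C) ⟩
    ∑[ D ∈ IL C ] (if irank C D ≡ᵇ ℓ then #IncDec C D else 0)
      ≡⟨ ∑-filter (interlaces C) (lists (length C)) _ ⟩
    ∑[ D ∈ lists (length C) ] (⟦ interlaces C D ⟧ * (if irank C D ≡ᵇ ℓ then #IncDec C D else 0))
      ≡⟨ ∑-cong (lists (length C)) (λ D → ⟦⟧-*-cong (interlaces C D) λ il →
           trans (sym (⟦⟧-* (irank C D ≡ᵇ ℓ) (#IncDec C D))) (cong (⟦ irank C D ≡ᵇ ℓ ⟧ *_) (#IncDec≡∏#decreasing C D ch il))) ⟩
    interlacingSum C ℓ
      ∎
    where open ≡-Reasoning

  poinInt≡ : ∀ A B ℓ → poinInt A B ℓ ≡ ∑[ X ∈ elems ] (⟦ leq A X ∧ (leq X B ∧ ((rank X ∸ rank A) ≡ᵇ ℓ)) ⟧ * #chains strictDec A X)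
  poinInt≡ A B ℓ = begin
    sum (map (λ X → ∣ μ A X ∣) (filterᵇ inInterval elems))
      ≡⟨ sum-map _ (filterᵇ inInterval elems) ⟩
    ∑[ X ∈ filterᵇ inInterval elems ] ∣ μ A X ∣
      ≡⟨ ∑-filter inInterval elems _ ⟩
    ∑[ X ∈ elems ] (⟦ inInterval X ⟧ * ∣ μ A X ∣)
      ≡⟨ ∑-cong elems (λ X → ⟦⟧-*-cong (inInterval X) (∣μ∣≡#decreasing ∘ proj₁ ∘ to (T-∧ {leq A X}))) ⟩
    ∑[ X ∈ elems ] (⟦ inInterval X ⟧ * #chains strictDec A X)
      ∎
    where
    open ≡-Reasoning
    inInterval : El → Bool
    inInterval X = leq A X ∧ (leq X B ∧ ((rank X ∸ rank A) ≡ᵇ ℓ))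

  interlaced-ranks : ∀ C D → T (interlaces C D) → sum (map rank C) ≤ sum (map rank D)
  interlaced-ranks []            []       _  = z≤n
  interlaced-ranks (c ∷ [])      (d ∷ []) il = +-monoˡ-≤ 0 (rank-mono il)
  interlaced-ranks (c ∷ c′ ∷ cs) (d ∷ ds) il with to (T-∧ {leq c d}) il
  ... | c≤d , il′ = +-mono-≤ (rank-mono c≤d) (interlaced-ranks (c′ ∷ cs) ds (proj₂ (to (T-∧ {leq d c′}) il′)))

  irank-∷ : ∀ {c d} C D → T (leq c d) → T (interlaces C D) → irank (c ∷ C) (d ∷ D) ≡ (rank d ∸ rank c) + irank C D
  irank-∷ C D c≤d il = ∸-distrib-+ (rank-mono c≤d) (interlaced-ranks C D il)

  upper : List El → El
  upper []      = top
  upper (c ∷ _) = c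

  interlaces-∷ : ∀ c d C D → interlaces (c ∷ C) (d ∷ D) ≡ (leq c d ∧ leq d (upper C)) ∧ interlaces C D
  interlaces-∷ c d []       []      rewrite to T-≡ (top-max d) = sym (trans (∧-identityʳ _) (∧-identityʳ _))
  interlaces-∷ c d []       (_ ∷ _) = sym (∧-zeroʳ _)
  interlaces-∷ c d (c′ ∷ C) D       = sym (∧-assoc (leq c d) (leq d c′) (interlaces (c′ ∷ C) D))

  intervalProduct : El → El → Poly → Poly
  intervalProduct c u F ℓ =
    ∑[ d ∈ elems ] (⟦ leq c d ∧ leq d u ⟧ * (#chains strictDec c d * (⟦ (rank d ∸ rank c) ≤ᵇ ℓ ⟧ * F (ℓ ∸ (rank d ∸ rank c)))))

  intervalProduct-cong : ∀ c u {F F′ : Poly} → (∀ k → F k ≡ F′ k) → ∀ ℓ → intervalProduct c u F ℓ ≡ intervalProduct c u F′ ℓ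
  intervalProduct-cong c u F≡F′ ℓ = ∑-cong elems (λ d →
    cong (λ v → ⟦ leq c d ∧ leq d u ⟧ * (#chains strictDec c d * (⟦ (rank d ∸ rank c) ≤ᵇ ℓ ⟧ * v))) (F≡F′ _))

  interlacingSum-∷ : ∀ c C ℓ → interlacingSum (c ∷ C) ℓ ≡ intervalProduct c (upper C) (interlacingSum C) ℓ
  interlacingSum-∷ c C ℓ = trans (∑-lists-∷ (length C) _) (∑-cong elems at)
    where
    open ≡-Reasoning
    at : ∀ d → ∑[ D ∈ lists (length C) ] (⟦ interlaces (c ∷ C) (d ∷ D) ⟧ * (⟦ irank (c ∷ C) (d ∷ D) ≡ᵇ ℓ ⟧ * ∏#decreasing (c ∷ C) (d ∷ D))) ≡
               ⟦ leq c d ∧ leq d (upper C) ⟧ * (#chains strictDec c d * (⟦ (rank d ∸ rank c) ≤ᵇ ℓ ⟧ * interlacingSum C (ℓ ∸ (rank d ∸ rank c))))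
    at d = begin
      ∑[ D ∈ Ds ] (⟦ interlaces (c ∷ C) (d ∷ D) ⟧ * (⟦ irank (c ∷ C) (d ∷ D) ≡ᵇ ℓ ⟧ * (dec * ∏#decreasing C D)))
        ≡⟨ ∑-cong Ds term ⟩
      ∑[ D ∈ Ds ] (⟦ AB ⟧ * (dec * (⟦ e ≤ᵇ ℓ ⟧ * (⟦ interlaces C D ⟧ * (⟦ irank C D ≡ᵇ (ℓ ∸ e) ⟧ * ∏#decreasing C D)))))
        ≡⟨ *-distribˡ-∑ ⟦ AB ⟧ Ds _ ⟨
      ⟦ AB ⟧ * ∑[ D ∈ Ds ] (dec * (⟦ e ≤ᵇ ℓ ⟧ * (⟦ interlaces C D ⟧ * (⟦ irank C D ≡ᵇ (ℓ ∸ e) ⟧ * ∏#decreasing C D))))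
        ≡⟨ cong (⟦ AB ⟧ *_) (trans (sym (*-distribˡ-∑ dec Ds _)) (cong (dec *_) (sym (*-distribˡ-∑ ⟦ e ≤ᵇ ℓ ⟧ Ds _)))) ⟩
      ⟦ AB ⟧ * (dec * (⟦ e ≤ᵇ ℓ ⟧ * interlacingSum C (ℓ ∸ e)))
        ∎
      where
      Ds = lists (length C)
      AB = leq c d ∧ leq d (upper C)
      dec = #chains strictDec c d
      e = rank d ∸ rank c
      rearrange : ∀ ab i le r≡ dec p → (ab * i) * ((le * r≡) * (dec * p)) ≡ ab * (dec * (le * (i * (r≡ * p))))
      rearrange = solve-∀
      term : ∀ D → ⟦ interlaces (c ∷ C) (d ∷ D) ⟧ * (⟦ irank (c ∷ C) (d ∷ D) ≡ᵇ ℓ ⟧ * (dec * ∏#decreasing C D)) ≡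
                   ⟦ AB ⟧ * (dec * (⟦ e ≤ᵇ ℓ ⟧ * (⟦ interlaces C D ⟧ * (⟦ irank C D ≡ᵇ (ℓ ∸ e) ⟧ * ∏#decreasing C D))))
      term D = begin
        ⟦ interlaces (c ∷ C) (d ∷ D) ⟧ * (⟦ irank (c ∷ C) (d ∷ D) ≡ᵇ ℓ ⟧ * (dec * ∏#decreasing C D))
          ≡⟨ cong (λ b → ⟦ b ⟧ * (⟦ irank (c ∷ C) (d ∷ D) ≡ᵇ ℓ ⟧ * (dec * ∏#decreasing C D))) (interlaces-∷ c d C D) ⟩
        ⟦ AB ∧ interlaces C D ⟧ * (⟦ irank (c ∷ C) (d ∷ D) ≡ᵇ ℓ ⟧ * (dec * ∏#decreasing C D))
          ≡⟨ ⟦⟧-*-cong (AB ∧ interlaces C D) (λ t → let ab , il = to (T-∧ {AB}) t in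
               cong (λ b → ⟦ b ⟧ * (dec * ∏#decreasing C D))
                 (trans (cong (_≡ᵇ ℓ) (irank-∷ C D (proj₁ (to (T-∧ {leq c d}) ab)) il)) (≡ᵇ-+ e (irank C D) ℓ))) ⟩
        ⟦ AB ∧ interlaces C D ⟧ * (⟦ (e ≤ᵇ ℓ) ∧ (irank C D ≡ᵇ (ℓ ∸ e)) ⟧ * (dec * ∏#decreasing C D))
          ≡⟨ cong₂ (λ u v → u * (v * (dec * ∏#decreasing C D))) (⟦∧⟧ AB (interlaces C D)) (⟦∧⟧ (e ≤ᵇ ℓ) (irank C D ≡ᵇ (ℓ ∸ e))) ⟩
        (⟦ AB ⟧ * ⟦ interlaces C D ⟧) * ((⟦ e ≤ᵇ ℓ ⟧ * ⟦ irank C D ≡ᵇ (ℓ ∸ e) ⟧) * (dec * ∏#decreasing C D))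
          ≡⟨ rearrange ⟦ AB ⟧ ⟦ interlaces C D ⟧ ⟦ e ≤ᵇ ℓ ⟧ ⟦ irank C D ≡ᵇ (ℓ ∸ e) ⟧ dec (∏#decreasing C D) ⟩
        ⟦ AB ⟧ * (dec * (⟦ e ≤ᵇ ℓ ⟧ * (⟦ interlaces C D ⟧ * (⟦ irank C D ≡ᵇ (ℓ ∸ e) ⟧ * ∏#decreasing C D))))
          ∎

  onePoly≡⟦0≡ᵇ⟧ : ∀ k → onePoly k ≡ ⟦ 0 ≡ᵇ k ⟧
  onePoly≡⟦0≡ᵇ⟧ zero    = refl
  onePoly≡⟦0≡ᵇ⟧ (suc k) = refl

  poinInt≡intervalProduct : ∀ c u ℓ → poinInt c u ℓ ≡ intervalProduct c u onePoly ℓ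
  poinInt≡intervalProduct c u ℓ = trans (poinInt≡ c u ℓ) (∑-cong elems at)
    where
    open ≡-Reasoning
    at : ∀ d → ⟦ leq c d ∧ (leq d u ∧ ((rank d ∸ rank c) ≡ᵇ ℓ)) ⟧ * #chains strictDec c d ≡
               ⟦ leq c d ∧ leq d u ⟧ * (#chains strictDec c d * (⟦ (rank d ∸ rank c) ≤ᵇ ℓ ⟧ * onePoly (ℓ ∸ (rank d ∸ rank c))))
    at d = begin
      ⟦ leq c d ∧ (leq d u ∧ (e ≡ᵇ ℓ)) ⟧ * dec
        ≡⟨ cong (λ b → ⟦ b ⟧ * dec) (∧-assoc (leq c d) (leq d u) (e ≡ᵇ ℓ)) ⟨
      ⟦ (leq c d ∧ leq d u) ∧ (e ≡ᵇ ℓ) ⟧ * dec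
        ≡⟨ cong (_* dec) (⟦∧⟧ (leq c d ∧ leq d u) (e ≡ᵇ ℓ)) ⟩
      ⟦ leq c d ∧ leq d u ⟧ * ⟦ e ≡ᵇ ℓ ⟧ * dec
        ≡⟨ cong (λ b → ⟦ leq c d ∧ leq d u ⟧ * ⟦ b ⟧ * dec) (trans (cong (_≡ᵇ ℓ) (sym (+-identityʳ e))) (≡ᵇ-+ e 0 ℓ)) ⟩
      ⟦ leq c d ∧ leq d u ⟧ * ⟦ (e ≤ᵇ ℓ) ∧ (0 ≡ᵇ (ℓ ∸ e)) ⟧ * dec
        ≡⟨ cong (λ v → ⟦ leq c d ∧ leq d u ⟧ * v * dec)
             (trans (⟦∧⟧ (e ≤ᵇ ℓ) _) (cong (⟦ e ≤ᵇ ℓ ⟧ *_) (sym (onePoly≡⟦0≡ᵇ⟧ (ℓ ∸ e))))) ⟩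
      ⟦ leq c d ∧ leq d u ⟧ * (⟦ e ≤ᵇ ℓ ⟧ * onePoly (ℓ ∸ e)) * dec
        ≡⟨ rearrange ⟦ leq c d ∧ leq d u ⟧ ⟦ e ≤ᵇ ℓ ⟧ (onePoly (ℓ ∸ e)) dec ⟩
      ⟦ leq c d ∧ leq d u ⟧ * (dec * (⟦ e ≤ᵇ ℓ ⟧ * onePoly (ℓ ∸ e)))
        ∎
      where
      e = rank d ∸ rank c
      dec = #chains strictDec c d
      rearrange : ∀ ab le o dec → ab * (le * o) * dec ≡ ab * (dec * (le * o))
      rearrange = solve-∀

  ⊛≡intervalProduct : ∀ c u F ℓ → (poinInt c u ⊛ F) ℓ ≡ intervalProduct c u F ℓ
  ⊛≡intervalProduct c u F ℓ = begin
    sum (map (λ i → poinInt c u i * F (ℓ ∸ i)) (upTo (suc ℓ)))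
      ≡⟨ sum-map _ (upTo (suc ℓ)) ⟩
    ∑[ i ∈ upTo (suc ℓ) ] (poinInt c u i * F (ℓ ∸ i))
      ≡⟨ ∑-cong (upTo (suc ℓ)) (λ i → trans (cong (_* F (ℓ ∸ i)) (poinInt≡ c u i)) (*-distribʳ-∑ _ elems _)) ⟩
    ∑[ i ∈ upTo (suc ℓ) ] ∑[ d ∈ elems ] (⟦ leq c d ∧ (leq d u ∧ (e d ≡ᵇ i)) ⟧ * dec d * F (ℓ ∸ i))
      ≡⟨ ∑-comm (upTo (suc ℓ)) elems _ ⟩
    ∑[ d ∈ elems ] ∑[ i ∈ upTo (suc ℓ) ] (⟦ leq c d ∧ (leq d u ∧ (e d ≡ᵇ i)) ⟧ * dec d * F (ℓ ∸ i))
      ≡⟨ ∑-cong elems at ⟩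
    intervalProduct c u F ℓ
      ∎
    where
    open ≡-Reasoning
    e : El → ℕ
    e d = rank d ∸ rank c
    dec : El → ℕ
    dec = #chains strictDec c
    rearrange : ∀ ab ei dec p → ab * ei * dec * p ≡ ab * (dec * (ei * p))
    rearrange = solve-∀
    at : ∀ d → ∑[ i ∈ upTo (suc ℓ) ] (⟦ leq c d ∧ (leq d u ∧ (e d ≡ᵇ i)) ⟧ * dec d * F (ℓ ∸ i)) ≡
               ⟦ leq c d ∧ leq d u ⟧ * (dec d * (⟦ e d ≤ᵇ ℓ ⟧ * F (ℓ ∸ e d)))
    at d = begin
      ∑[ i ∈ upTo (suc ℓ) ] (⟦ leq c d ∧ (leq d u ∧ (e d ≡ᵇ i)) ⟧ * dec d * F (ℓ ∸ i))
        ≡⟨ ∑-cong (upTo (suc ℓ)) (λ i → trans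
             (cong (λ v → v * dec d * F (ℓ ∸ i))
               (trans (cong ⟦_⟧ (sym (∧-assoc (leq c d) (leq d u) (e d ≡ᵇ i)))) (⟦∧⟧ (leq c d ∧ leq d u) (e d ≡ᵇ i))))
             (rearrange ⟦ leq c d ∧ leq d u ⟧ ⟦ e d ≡ᵇ i ⟧ (dec d) (F (ℓ ∸ i)))) ⟩
      ∑[ i ∈ upTo (suc ℓ) ] (⟦ leq c d ∧ leq d u ⟧ * (dec d * (⟦ e d ≡ᵇ i ⟧ * F (ℓ ∸ i))))
        ≡⟨ *-distribˡ-∑ ⟦ leq c d ∧ leq d u ⟧ (upTo (suc ℓ)) _ ⟨
      ⟦ leq c d ∧ leq d u ⟧ * ∑[ i ∈ upTo (suc ℓ) ] (dec d * (⟦ e d ≡ᵇ i ⟧ * F (ℓ ∸ i)))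
        ≡⟨ cong (⟦ leq c d ∧ leq d u ⟧ *_) (trans (sym (*-distribˡ-∑ (dec d) (upTo (suc ℓ)) _))
             (cong (dec d *_) (∑-upTo-δ ℓ (e d) (λ i → F (ℓ ∸ i))))) ⟩
      ⟦ leq c d ∧ leq d u ⟧ * (dec d * (⟦ e d ≤ᵇ ℓ ⟧ * F (ℓ ∸ e d)))
        ∎

  poinC-∷ : ∀ c C ℓ → poinC (c ∷ C) ℓ ≡ intervalProduct c (upper C) (poinC C) ℓ
  poinC-∷ c []       ℓ = poinInt≡intervalProduct c top ℓ
  poinC-∷ c (c′ ∷ C) ℓ = ⊛≡intervalProduct c c′ (poinC (c′ ∷ C)) ℓ

  poinC≡interlacingSum : ∀ C ℓ → poinC C ℓ ≡ interlacingSum C ℓ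
  poinC≡interlacingSum []      zero    = refl
  poinC≡interlacingSum []      (suc ℓ) = refl
  poinC≡interlacingSum (c ∷ C) ℓ = begin
    poinC (c ∷ C) ℓ                                      ≡⟨ poinC-∷ c C ℓ ⟩
    intervalProduct c (upper C) (poinC C) ℓ              ≡⟨ intervalProduct-cong c (upper C) (poinC≡interlacingSum C) ℓ ⟩
    intervalProduct c (upper C) (interlacingSum C) ℓ     ≡⟨ interlacingSum-∷ c C ℓ ⟨
    interlacingSum (c ∷ C) ℓ                             ∎
    where open ≡-Reasoning

proposition3p2 : (P : FinPoset) (G : IsGraded P) →
    let open GradedDefs P G in
    (lab : El → El → ℕ) → IsRLabeling lab →
    (C : List El) → T (isChain C) →
    ∀ (ℓ : ℕ) → poinC C ℓ ≡ Labels.rhsCoeff lab C ℓ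
proposition3p2 P G lab RL C ch ℓ =
  trans (poinC≡interlacingSum C ℓ) (sym (rhsCoeff≡interlacingSum C ℓ ch))
  where
  open Poincare P G lab RL
  open Relation.Binary.PropositionalEquality using (trans; sym)
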